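{- Let $(D,X,H,f)$ be a constructible configuration. Then (a) $f(X_v)=d_D(v)$ for all $v\in V(D)$, and (b) $(D,X,H,f)$ is uncolorable.
   Context: All digraphs are finite, without loops and parallel arcs (digons allowed); $d_D(v)=(d^+_D(v),d^-_D(v))$; pairs in $\mathbb{N}_0^2$ are added coordinatewise. Connected, block (maximal connected subdigraph with no vertex whose removal disconnects it) refer to the underlying graph. $D^\pm(G)$: replace each edge of undirected $G$ by a digon. Antidirected cycle: underlying graph a cycle, each vertex a source or a sink. Cover of $D$: pair $(X,H)$, $H$ disjoint from $D$, $X_v\subseteq V(H)$ pairwise disjoint with union $V(H)$, each independent in $H$, arcs of $H$ from $X_u$ to $X_v$ ($u\ne v$) a matching if $uv\in A(D)$, none otherwise. Transversal: $|T\cap X_v|=1$ for all $v$. For $U\subseteq V(H)$, $(X,H)/U$ is the cover $(X',H[U])$ of $D[\{v:X_v\cap U\ne\varnothing\}]$ with $X'_v=X_v\cap U$. A cover is saturated if for every arc $uv$ the arcs from $X_u$ to $X_v$ form a perfect matching of $H[X_u\cup X_v]$. For $f:V(H)\to\mathbb{N}_0^2$, $f=(f^+,f^-)$, $f(Y)=\sum_{y\in Y}f(y)$; $H$ is strictly $f$-degenerate if every nonempty subdigraph $H'$ of $H$ has a vertex $x$ with $d^+_{H'}(x)<f^+(x)$ or $d^-_{H'}(x)<f^-(x)$. A configuration is $(D,X,H,f)$ with $(X,H)$ a cover of $D$ and $f:V(H)\to\mathbb{N}_0^2$; it is colorable if some transversal $T$ has $H[T]$ strictly $f$-degenerate, uncolorable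 otherwise. $(D,X,H,f)$ is constructible if one of: (I) $D$ is a block and there is a transversal $T$ with $(X,H)/T$ saturated, $f(x)=d_D(v)$ for $x\in T\cap X_v$, $f=(0,0)$ off $T$; (II) $D=D^\pm(K_n)$, $n\ge1$, $n_1+\dots+n_p=n-1$ with $n_i\in\mathbb{N}$, $p\ge1$, pairwise disjoint transversals $T_1,\dots,T_p$ with $(X,H)/T_i$ saturated, $f=(n_i,n_i)$ on $T_i$, $(0,0)$ elsewhere; (III) $D=D^\pm(C_n)$, $n\ge5$ odd, disjoint transversals $T_1,T_2$ with $(X,H)/T_i$ saturated, $f=(1,1)$ on $T_1\cup T_2$, $(0,0)$ elsewhere; (IV) $D=D^\pm(C_n)$, $n\ge4$ even, disjoint transversals $T_1,T_2$ with $H[T_1\cup T_2]=D^\pm(C_{2n})$, $f=(1,1)$ on $T_1\cup T_2$, $(0,0)$ elsewhere; (V) $D$ an antidirected cycle on $n\ge4$ vertices, $n$ even, disjoint transversals $T_1,T_2$ with $H[T_1\cup T_2]$ an antidirected cycle on $2n$ vertices, and for $x\in X_v\cap(T_1\cup T_2)$, $f(x)=(1,0)$ if $v$ is a source of $D$ and $(0,1)$ if $v$ is a sink, $f=(0,0)$ elsewhere; (VI) $(D,X,H,f)$ is obtained from disjoint constructible configurations $(D^i,X^i,H^i,f^i)$, $i=1,2$, with $|D^i|<|D|$, by identifying $v^1\in V(D^1)$ and $v^2\in V(D^2)$ into one vertex, choosing a bijection $\pi:X^1_{v^1}\to X^2_{v^2}$ and identifying each $x$ with $\pi(x)$ in $H$,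 with $f=f^i$ on $V(H^i)\setminus X^i_{v^i}$ and $f=f^1(x)+f^2(\pi(x))$ at the identified vertices. -}

module Defs where

open import Data.Nat using (ℕ; zero; suc; _+_; _∸_; _<_; _≤_)
open import Data.Bool using (Bool; true; false; _∧_; _∨_; if_then_else_; not)
open import Data.Fin using (Fin; zero; suc; toℕ; _≟_)
open import Data.Product using (Σ; ∃; ∃-syntax; _×_; _,_; proj₁; proj₂)
open import Data.Sum using (_⊎_)
open import Relation.Binary.PropositionalEquality using (_≡_; _≢_)
open import Relation.Nullary using (¬_)
open import Relation.Nullary.Decidable using (⌊_⌋)
open import Function.Bundles using (_⇔_)
open import Function.Definitions using (Injective)

ℕ² : Set
ℕ² = ℕ × ℕ

_⊕_ : ℕ² → ℕ² → ℕ²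
(a , b) ⊕ (c , d) = (a + c , b + d)

𝟘 : ℕ²
𝟘 = (0 , 0)

Subset : ℕ → Set
Subset m = Fin m → Bool

full : ∀ {m} → Subset m
full _ = true

sumℕ : ∀ {m} → (Fin m → ℕ) → ℕ
sumℕ {zero}  g = 0
sumℕ {suc m} g = g zero + sumℕ (λ i → g (suc i))

count : ∀ {m} → Subset m → ℕ
count P = sumℕ (λ i → if P i then 1 else 0)

sum² : ∀ {m} → Subset m → (Fin m → ℕ²) → ℕ²
sum² {zero}  P g = 𝟘
sum² {suc m} P g =
  (if P zero then g zero else 𝟘) ⊕ sum² (λ i → P (suc i)) (λ i → g (suc i))

Odd : ℕ → Set
Odd n = ∃[ k ] n ≡ suc (k + k)

Even : ℕ → Set
Even n = ∃[ k ] n ≡ k + k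

-- Digraphs: vertex set Fin size, arc relation (no loops, no parallel arcs;
-- digons allowed)

record Digraph : Set where
  field
    size     : ℕ
    arc      : Fin size → Fin size → Bool
    loopless : ∀ v → arc v v ≡ false
open Digraph public

outdeg : (G : Digraph) → Fin (size G) → ℕ
outdeg G v = count (arc G v)

indeg : (G : Digraph) → Fin (size G) → ℕ
indeg G v = count (λ w → arc G w v)

deg : (G : Digraph) → Fin (size G) → ℕ²
deg G v = (outdeg G v , indeg G v)

IsSource : (G : Digraph) → Fin (size G) → Set
IsSource G v = ∀ w → arc G w v ≡ false

IsSink : (G : Digraph) → Fin (size G) → Set
IsSink G v = ∀ w → arc G v w ≡ false

data Path (G : Digraph) (ok : Subset (size G)) : Fin (size G) → Fin (size G) → Set where
  here : ∀ {a} → ok a ≡ true → Path G ok a a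
  step : ∀ {a b c} → ok a ≡ true → (arc G a b ∨ arc G b a) ≡ true →
         Path G ok b c → Path G ok a c

Connected : Digraph → Set
Connected G = 1 ≤ size G × (∀ a b → Path G full a b)

CutVertex : (G : Digraph) → Fin (size G) → Set
CutVertex G v = ∃[ a ] ∃[ b ] (a ≢ v × b ≢ v ×
                  ¬ Path G (λ w → not ⌊ w ≟ v ⌋) a b)

IsBlock : Digraph → Set
IsBlock G = Connected G × (∀ v → ¬ CutVertex G v)

IsCompleteSym : Digraph → Set
IsCompleteSym G = 1 ≤ size G × (∀ u v → (arc G u v ≡ true) ⇔ (u ≢ v))

CycAdj : (k : ℕ) → Fin k → Fin k → Set
CycAdj k i j = toℕ j ≡ suc (toℕ i) ⊎ (suc (toℕ i) ≡ k × toℕ j ≡ 0)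

SymAdj : (k : ℕ) → Fin k → Fin k → Set
SymAdj k i j = CycAdj k i j ⊎ CycAdj k j i

InducedSymCycle : (G : Digraph) → Subset (size G) → ℕ → Set
InducedSymCycle G S k =
  Σ (Fin k → Fin (size G)) λ σ →
    Injective _≡_ _≡_ σ ×
    (∀ x → (S x ≡ true) ⇔ (∃[ i ] σ i ≡ x)) ×
    (∀ i j → (arc G (σ i) (σ j) ≡ true) ⇔ SymAdj k i j)

InducedAntiCycle : (G : Digraph) → Subset (size G) → ℕ → Set
InducedAntiCycle G S k =
  Σ (Fin k → Fin (size G)) λ σ →
    Injective _≡_ _≡_ σ ×
    (∀ x → (S x ≡ true) ⇔ (∃[ i ] σ i ≡ x)) ×
    (∀ i j → ((arc G (σ i) (σ j) ∨ arc G (σ j) (σ i)) ≡ true) ⇔ SymAdj k i j) ×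
    (∀ i → (∀ j → arc G (σ j) (σ i) ≡ false) ⊎ (∀ j → arc G (σ i) (σ j) ≡ false))

-- Covers and configurations.  X : V(H) → V(D) sends x to the v with x ∈ X_v
-- (so the X_v are pairwise disjoint with union V(H)).

record IsCover (D H : Digraph) (X : Fin (size H) → Fin (size D)) : Set where
  field
    independent : ∀ x y → X x ≡ X y → arc H x y ≡ false
    noArc       : ∀ x y → arc H x y ≡ true → X x ≢ X y → arc D (X x) (X y) ≡ true
    matchingOut : ∀ x y y′ → arc H x y ≡ true → arc H x y′ ≡ true → X y ≡ X y′ → y ≡ y′
    matchingIn  : ∀ x x′ y → arc H x y ≡ true → arc H x′ y ≡ true → X x ≡ X x′ → x ≡ x′

record Config : Set where
  field
    D     : Digraph
    H     : Digraph
    X     : Fin (size H) → Fin (size D)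
    f     : Fin (size H) → ℕ²
    cover : IsCover D H X
open Config public

module _ (C : Config) where

  inX : Fin (size (D C)) → Subset (size (H C))
  inX v x = ⌊ X C x ≟ v ⌋

  Transversal : Subset (size (H C)) → Set
  Transversal T = ∀ v → count (λ x → T x ∧ inX v x) ≡ 1

  Saturated : Subset (size (H C)) → Set
  Saturated U =
    ∀ u v → arc (D C) u v ≡ true →
      (∃[ x ] (U x ≡ true × X C x ≡ u)) →
      (∃[ y ] (U y ≡ true × X C y ≡ v)) →
      (∀ x → U x ≡ true → X C x ≡ u →
         ∃[ y ] (U y ≡ true × X C y ≡ v × arc (H C) x y ≡ true)) ×
      (∀ y → U y ≡ true → X C y ≡ v →
         ∃[ x ] (U x ≡ true × X C x ≡ u × arc (H C) x y ≡ true))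

  StrictlyDegenerate : Subset (size (H C)) → Set
  StrictlyDegenerate T =
    ∀ (S : Subset (size (H C))) (B : Fin (size (H C)) → Fin (size (H C)) → Bool) →
      (∀ x → S x ≡ true → T x ≡ true) →
      (∀ x y → B x y ≡ true → arc (H C) x y ≡ true × S x ≡ true × S y ≡ true) →
      (∃[ x ] S x ≡ true) →
      ∃[ x ] (S x ≡ true ×
              (count (B x) < proj₁ (f C x) ⊎ count (λ y → B y x) < proj₂ (f C x)))

  Colorable : Set
  Colorable = ∃[ T ] (Transversal T × StrictlyDegenerate T)

  Disjoint : Subset (size (H C)) → Subset (size (H C)) → Set
  Disjoint T₁ T₂ = ∀ x → T₁ x ≡ true → T₂ x ≡ false

-- Gluing (VI): C is obtained from C₁, C₂ by identifying v₁ and v₂ and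
-- X¹_{v₁} with X²_{v₂} along a bijection π (described up to isomorphism by
-- embeddings φᵢ : V(Dⁱ) → V(D), ψᵢ : V(Hⁱ) → V(H)).

record Glue (C₁ C₂ C : Config) : Set where
  field
    v₁ : Fin (size (D C₁))
    v₂ : Fin (size (D C₂))
    φ₁ : Fin (size (D C₁)) → Fin (size (D C))
    φ₂ : Fin (size (D C₂)) → Fin (size (D C))
    φ₁-inj : Injective _≡_ _≡_ φ₁
    φ₂-inj : Injective _≡_ _≡_ φ₂
    φ-glue : φ₁ v₁ ≡ φ₂ v₂
    φ-only : ∀ a b → φ₁ a ≡ φ₂ b → a ≡ v₁ × b ≡ v₂
    φ-onto : ∀ u → (∃[ a ] φ₁ a ≡ u) ⊎ (∃[ b ] φ₂ b ≡ u)
    D-arcs : ∀ u w → (arc (D C) u w ≡ true) ⇔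
               ((∃[ a ] ∃[ b ] (φ₁ a ≡ u × φ₁ b ≡ w × arc (D C₁) a b ≡ true)) ⊎
                (∃[ a ] ∃[ b ] (φ₂ a ≡ u × φ₂ b ≡ w × arc (D C₂) a b ≡ true)))
    ψ₁ : Fin (size (H C₁)) → Fin (size (H C))
    ψ₂ : Fin (size (H C₂)) → Fin (size (H C))
    ψ₁-inj : Injective _≡_ _≡_ ψ₁
    ψ₂-inj : Injective _≡_ _≡_ ψ₂
    ψ-only : ∀ x y → ψ₁ x ≡ ψ₂ y → X C₁ x ≡ v₁ × X C₂ y ≡ v₂
    -- π : X¹_{v₁} → X²_{v₂} bijection, x identified with π(x)
    π-tot  : ∀ x → X C₁ x ≡ v₁ → ∃[ y ] ψ₁ x ≡ ψ₂ y
    π-sur  : ∀ y → X C₂ y ≡ v₂ → ∃[ x ] ψ₁ x ≡ ψ₂ y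
    ψ-onto : ∀ z → (∃[ x ] ψ₁ x ≡ z) ⊎ (∃[ y ] ψ₂ y ≡ z)
    X₁-com : ∀ x → X C (ψ₁ x) ≡ φ₁ (X C₁ x)
    X₂-com : ∀ y → X C (ψ₂ y) ≡ φ₂ (X C₂ y)
    H-arcs : ∀ z w → (arc (H C) z w ≡ true) ⇔
               ((∃[ x ] ∃[ y ] (ψ₁ x ≡ z × ψ₁ y ≡ w × arc (H C₁) x y ≡ true)) ⊎
                (∃[ x ] ∃[ y ] (ψ₂ x ≡ z × ψ₂ y ≡ w × arc (H C₂) x y ≡ true)))
    f₁-com : ∀ x → X C₁ x ≢ v₁ → f C (ψ₁ x) ≡ f C₁ x
    f₂-com : ∀ y → X C₂ y ≢ v₂ → f C (ψ₂ y) ≡ f C₂ y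
    f-glue : ∀ x y → ψ₁ x ≡ ψ₂ y → f C (ψ₁ x) ≡ f C₁ x ⊕ f C₂ y

data Constructible : Config → Set where
  caseI : ∀ C → IsBlock (D C) →
    (T : Subset (size (H C))) → Transversal C T → Saturated C T →
    (∀ x → T x ≡ true → f C x ≡ deg (D C) (X C x)) →
    (∀ x → T x ≡ false → f C x ≡ 𝟘) →
    Constructible C
  caseII : ∀ C → IsCompleteSym (D C) →
    (p : ℕ) → 1 ≤ p → (ns : Fin p → ℕ) → (∀ i → 1 ≤ ns i) →
    sumℕ ns ≡ size (D C) ∸ 1 →
    (Ts : Fin p → Subset (size (H C))) →
    (∀ i j x → Ts i x ≡ true → Ts j x ≡ true → i ≡ j) →
    (∀ i → Transversal C (Ts i)) → (∀ i → Saturated C (Ts i)) →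
    (∀ i x → Ts i x ≡ true → f C x ≡ (ns i , ns i)) →
    (∀ x → (∀ i → Ts i x ≡ false) → f C x ≡ 𝟘) →
    Constructible C
  caseIII : ∀ C → InducedSymCycle (D C) full (size (D C)) →
    5 ≤ size (D C) → Odd (size (D C)) →
    (T₁ T₂ : Subset (size (H C))) → Disjoint C T₁ T₂ →
    Transversal C T₁ → Transversal C T₂ → Saturated C T₁ → Saturated C T₂ →
    (∀ x → (T₁ x ∨ T₂ x) ≡ true → f C x ≡ (1 , 1)) →
    (∀ x → (T₁ x ∨ T₂ x) ≡ false → f C x ≡ 𝟘) →
    Constructible C
  caseIV : ∀ C → InducedSymCycle (D C) full (size (D C)) →
    4 ≤ size (D C) → Even (size (D C)) →
    (T₁ T₂ : Subset (size (H C))) → Disjoint C T₁ T₂ →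
    Transversal C T₁ → Transversal C T₂ →
    InducedSymCycle (H C) (λ x → T₁ x ∨ T₂ x) (size (D C) + size (D C)) →
    (∀ x → (T₁ x ∨ T₂ x) ≡ true → f C x ≡ (1 , 1)) →
    (∀ x → (T₁ x ∨ T₂ x) ≡ false → f C x ≡ 𝟘) →
    Constructible C
  caseV : ∀ C → InducedAntiCycle (D C) full (size (D C)) →
    4 ≤ size (D C) → Even (size (D C)) →
    (T₁ T₂ : Subset (size (H C))) → Disjoint C T₁ T₂ →
    Transversal C T₁ → Transversal C T₂ →
    InducedAntiCycle (H C) (λ x → T₁ x ∨ T₂ x) (size (D C) + size (D C)) →
    (∀ x → (T₁ x ∨ T₂ x) ≡ true → IsSource (D C) (X C x) → f C x ≡ (1 , 0)) →
    (∀ x → (T₁ x ∨ T₂ x) ≡ true → IsSink (D C) (X C x) → f C x ≡ (0 , 1)) →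
    (∀ x → (T₁ x ∨ T₂ x) ≡ false → f C x ≡ 𝟘) →
    Constructible C
  caseVI : ∀ C₁ C₂ C → Constructible C₁ → Constructible C₂ →
    size (D C₁) < size (D C) → size (D C₂) < size (D C) →
    Glue C₁ C₂ C →
    Constructible C

-- (a) is bookkeeping: in each base case f lives on transversals, where it is a share of the
-- degree, and in a gluing both the degree of the identified vertex and the f-values over it add.
--
-- (b) For every transversal T we exhibit an obstruction: a nonempty S ⊆ T such that in H[S] every
-- vertex has out- and in-degree at least f.  A vertex of T with f = 0 is one; otherwise T lies in
-- the support of f, and
--   (I)   T itself is one, by saturation;
--   (II)  by pigeonhole some Tᵢ contains more than nᵢ vertices of T, which span a complete digraph;
--   (III) along the odd cycle two consecutive vertices of T lie in the same Tᵢ and span a digon;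
--   (IV, V) T consists of n vertices of the 2n-cycle H[T₁ ∪ T₂], which winds twice around D, so two
--         of them are consecutive: a digon, resp. an arc from a source fibre to a sink fibre;
--   (VI)  T restricts to transversals of both parts; an obstruction of one part avoiding the
--         identified vertex maps into H, and otherwise the union of both images is an obstruction.

module Submission where

open import Defs
open import Data.Fin using (_≟_)
open import Data.Product using (_×_)
open import Relation.Binary.PropositionalEquality using (_≡_)
open import Relation.Nullary using (¬_)

open import Axiom.UniquenessOfIdentityProofs using (module Decidable⇒UIP)
open import Data.Bool as Bool using (Bool; true; false; _∧_; _∨_; not; _xor_; if_then_else_)
open import Data.Bool.Properties
  using (∧-identityʳ; ∧-zeroʳ; ∧-distribʳ-∨; ∨-identityʳ; not-involutive; not-¬; ¬-not;
         xor-identityʳ; not-distribˡ-xor; not-distribʳ-xor)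
open import Data.Empty using (⊥; ⊥-elim)
open import Data.Fin as Fin using (Fin; zero; suc; toℕ; fromℕ<; inject₁)
import Data.Fin.Properties as Finₚ
open import Data.Nat using (ℕ; zero; suc; _+_; _∸_; _≤_; _<_; _<?_; z≤n; s≤s; s≤s⁻¹)
open import Data.Nat.Properties renaming (_≟_ to _≟ℕ_)
open import Algebra.Properties.CommutativeSemigroup +-commutativeSemigroup
  using () renaming (interchange to +-interchange; x∙yz≈y∙xz to +-exchange)
open import Data.Product as Product using (∃₂; ∃-syntax; _,_; proj₁; proj₂)
import Data.Product.Properties as Productₚ
open import Data.Sum as Sum using (_⊎_; inj₁; inj₂)
open import Data.Vec.Functional using (_∷_; [])
open import Function using (_∘_; case_of_)
open import Function.Bundles using (Equivalence; _⇔_; mk⇔)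
open import Function.Definitions using (Injective)
open import Relation.Binary.PropositionalEquality
  using (refl; sym; trans; cong; cong₂; subst; subst₂; _≢_; module ≡-Reasoning)
open import Relation.Nullary using (Dec; yes; no; _×-dec_)
open import Relation.Nullary.Decidable using (⌊_⌋)

∧-true : ∀ {a b} → a ∧ b ≡ true → a ≡ true × b ≡ true
∧-true {true} e = refl , e

∧-intro : ∀ {a b} → a ≡ true → b ≡ true → a ∧ b ≡ true
∧-intro refl refl = refl

∨-true : ∀ {a b} → a ∨ b ≡ true → a ≡ true ⊎ b ≡ true
∨-true {true}  _ = inj₁ refl
∨-true {false} e = inj₂ e

∨-introˡ : ∀ {a} b → a ≡ true → a ∨ b ≡ true
∨-introˡ _ refl = refl

∨-introʳ : ∀ a {b} → b ≡ true → a ∨ b ≡ true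
∨-introʳ true  _ = refl
∨-introʳ false e = e

∧-false : ∀ {a b} → (a ≡ true → b ≡ true → ⊥) → a ∧ b ≡ false
∧-false {true}  {true}  both = ⊥-elim (both refl refl)
∧-false {true}  {false} _    = refl
∧-false {false}         _    = refl

∨-agreeing : ∀ {p q r s} → p ∨ q ≡ true → r ∨ s ≡ true → r ≡ p →
  (p ≡ true × r ≡ true) ⊎ (q ≡ true × s ≡ true)
∨-agreeing {true}             _   _   r≡p = inj₁ (refl , r≡p)
∨-agreeing {false} {r = false} q≡true s≡true _ = inj₂ (q≡true , s≡true)

≡true-ext : ∀ {a b} → (a ≡ true → b ≡ true) → (b ≡ true → a ≡ true) → a ≡ b
≡true-ext {true}  a⇒b _ = sym (a⇒b refl)
≡true-ext {false} {true} _ b⇒a = b⇒a refl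
≡true-ext {false} {false} _ _ = refl

⌊⌋⇒ : ∀ {A : Set} (a? : Dec A) → ⌊ a? ⌋ ≡ true → A
⌊⌋⇒ (yes a) _ = a
⌊⌋⇒ (no _) ()

⇒⌊⌋ : ∀ {A : Set} (a? : Dec A) → A → ⌊ a? ⌋ ≡ true
⇒⌊⌋ (yes _) _ = refl
⇒⌊⌋ (no ¬a) a = ⊥-elim (¬a a)

find : ∀ {m} (p : Fin m → Bool) → (∃[ i ] p i ≡ true) ⊎ (∀ i → p i ≡ false)
find p with Finₚ.any? (λ i → p i Bool.≟ true)
... | yes found = inj₁ found
... | no none = inj₂ λ i → ¬-not (λ e → none (i , e))

⌊suc≟suc⌋ : ∀ {m} (x y : Fin m) → ⌊ suc x ≟ suc y ⌋ ≡ ⌊ x ≟ y ⌋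
⌊suc≟suc⌋ x y with x ≟ y
... | yes _ = refl
... | no _ = refl

⊕-identityʳ : ∀ p → p ⊕ 𝟘 ≡ p
⊕-identityʳ (a , b) = cong₂ _,_ (+-identityʳ a) (+-identityʳ b)

⊕-comm : ∀ p q → p ⊕ q ≡ q ⊕ p
⊕-comm (a , b) (c , d) = cong₂ _,_ (+-comm a c) (+-comm b d)

⊕-interchange : ∀ p q r s → (p ⊕ q) ⊕ (r ⊕ s) ≡ (p ⊕ r) ⊕ (q ⊕ s)
⊕-interchange (a , a′) (b , b′) (c , c′) (d , d′) =
  cong₂ _,_ (+-interchange a b c d) (+-interchange a′ b′ c′ d′)

⊕-exchange : ∀ p q r → p ⊕ (q ⊕ r) ≡ q ⊕ (p ⊕ r)
⊕-exchange (a , a′) (b , b′) (c , c′) = cong₂ _,_ (+-exchange a b c) (+-exchange a′ b′ c′)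

_∖_ : ∀ {m} → Subset m → Fin m → Subset m
(P ∖ y) x = if ⌊ x ≟ y ⌋ then false else P x

∖-intro : ∀ {m} (P : Subset m) {x y} → P x ≡ true → x ≢ y → (P ∖ y) x ≡ true
∖-intro P {x} {y} Px x≢y with x ≟ y
... | yes x≡y = ⊥-elim (x≢y x≡y)
... | no _    = Px

∖-elim : ∀ {m} (P : Subset m) {x y} → (P ∖ y) x ≡ true → P x ≡ true × x ≢ y
∖-elim P {x} {y} x∈P∖y with x ≟ y
... | no x≢y = x∈P∖y , x≢y

sum²-congˢ : ∀ {m} {P Q : Subset m} (g : Fin m → ℕ²) → (∀ x → P x ≡ Q x) → sum² P g ≡ sum² Q g
sum²-congˢ {zero}  g P≗Q = refl
sum²-congˢ {suc m} g P≗Q rewrite P≗Q zero = cong (_ ⊕_) (sum²-congˢ (g ∘ suc) (P≗Q ∘ suc))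

sum²-cong : ∀ {m} (P : Subset m) {g g′ : Fin m → ℕ²} →
  (∀ x → P x ≡ true → g x ≡ g′ x) → sum² P g ≡ sum² P g′
sum²-cong {zero}  P g≗g′ = refl
sum²-cong {suc m} P g≗g′ with P zero in P₀
... | true  = cong₂ _⊕_ (g≗g′ zero P₀) (sum²-cong (P ∘ suc) (g≗g′ ∘ suc))
... | false = sum²-cong (P ∘ suc) (g≗g′ ∘ suc)

sum²-zero : ∀ {m} (P : Subset m) (g : Fin m → ℕ²) → (∀ x → P x ≡ true → g x ≡ 𝟘) → sum² P g ≡ 𝟘
sum²-zero P g g≗𝟘 = trans (sum²-cong P g≗𝟘) (sum²-𝟘 P)
  where
  sum²-𝟘 : ∀ {m} (P : Subset m) → sum² P (λ _ → 𝟘) ≡ 𝟘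
  sum²-𝟘 {zero}  P = refl
  sum²-𝟘 {suc m} P with P zero
  ... | true  = sum²-𝟘 (P ∘ suc)
  ... | false = sum²-𝟘 (P ∘ suc)

sum²-⊕ : ∀ {m} (P : Subset m) (g g′ : Fin m → ℕ²) →
  sum² P (λ x → g x ⊕ g′ x) ≡ sum² P g ⊕ sum² P g′
sum²-⊕ {zero}  P g g′ = refl
sum²-⊕ {suc m} P g g′ with P zero
... | true  = trans (cong (_ ⊕_) (sum²-⊕ (P ∘ suc) (g ∘ suc) (g′ ∘ suc)))
                    (⊕-interchange (g zero) (g′ zero) _ _)
... | false = sum²-⊕ (P ∘ suc) (g ∘ suc) (g′ ∘ suc)

sum²-remove : ∀ {m} (P : Subset m) (g : Fin m → ℕ²) {y} → P y ≡ true →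
  sum² P g ≡ g y ⊕ sum² (P ∖ y) g
sum²-remove {suc m} P g {zero} Py rewrite Py = refl
sum²-remove {suc m} P g {suc y} Py = begin
  head ⊕ sum² (P ∘ suc) (g ∘ suc)                       ≡⟨ cong (head ⊕_) (sum²-remove (P ∘ suc) _ Py) ⟩
  head ⊕ (g (suc y) ⊕ sum² ((P ∘ suc) ∖ y) (g ∘ suc))   ≡⟨ ⊕-exchange head (g (suc y)) _ ⟩
  g (suc y) ⊕ (head ⊕ sum² ((P ∘ suc) ∖ y) (g ∘ suc))   ≡⟨ cong (λ s → g (suc y) ⊕ (head ⊕ s))
                                                             (sum²-congˢ (g ∘ suc) suc-removed) ⟩
  g (suc y) ⊕ sum² (P ∖ suc y) g                        ∎
  where
  open ≡-Reasoning
  head : ℕ²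
  head = if P zero then g zero else 𝟘
  suc-removed : ∀ i → ((P ∘ suc) ∖ y) i ≡ (P ∖ suc y) (suc i)
  suc-removed i = cong (λ b → if b then false else P (suc i)) (sym (⌊suc≟suc⌋ i y))

tail-injective : ∀ {m p} {Q : Subset (suc p)} (h : ∀ i → Q i ≡ true → Fin m) →
  (∀ i j q r → h i q ≡ h j r → i ≡ j) → ∀ i j q r → h (suc i) q ≡ h (suc j) r → i ≡ j
tail-injective h h-inj i j q r e = Finₚ.suc-injective (h-inj (suc i) (suc j) q r e)

sum²-reindex : ∀ {m p} (P : Subset m) (g : Fin m → ℕ²) (Q : Subset p) (g′ : Fin p → ℕ²)
  (h : ∀ i → Q i ≡ true → Fin m) →
  (∀ i q → P (h i q) ≡ true) → (∀ i q → g (h i q) ≡ g′ i) →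
  (∀ i j q r → h i q ≡ h j r → i ≡ j) →
  (∀ x → P x ≡ true → (∃₂ λ i q → h i q ≡ x) ⊎ g x ≡ 𝟘) →
  sum² P g ≡ sum² Q g′
sum²-reindex {p = zero} P g Q g′ h _ _ _ onto = sum²-zero P g outside
  where
  outside : ∀ x → P x ≡ true → g x ≡ 𝟘
  outside x Px with onto x Px
  ... | inj₂ gx≡𝟘 = gx≡𝟘
sum²-reindex {m} {suc p} P g Q g′ h h∈P h-g h-inj onto with Q zero in Q₀
... | false = sum²-reindex P g (Q ∘ suc) (g′ ∘ suc) (h ∘ suc) (h∈P ∘ suc) (h-g ∘ suc)
                             (tail-injective h h-inj) onto′
  where
  onto′ : ∀ x → P x ≡ true → (∃₂ λ i q → h (suc i) q ≡ x) ⊎ g x ≡ 𝟘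
  onto′ x Px with onto x Px
  ... | inj₁ (zero , q , _)  = ⊥-elim (not-¬ q Q₀)
  ... | inj₁ (suc i , q , e) = inj₁ (i , q , e)
  ... | inj₂ gx≡𝟘            = inj₂ gx≡𝟘
... | true = trans (sum²-remove P g (h∈P zero Q₀))
                   (cong₂ _⊕_ (h-g zero Q₀) (sum²-reindex (P ∖ y) g (Q ∘ suc) (g′ ∘ suc) (h ∘ suc)
                                               h∈P∖y (h-g ∘ suc) (tail-injective h h-inj) onto′))
  where
  y : Fin m
  y = h zero Q₀
  h∈P∖y : ∀ i q → (P ∖ y) (h (suc i) q) ≡ true
  h∈P∖y i q = ∖-intro P (h∈P (suc i) q) (λ e → case h-inj (suc i) zero q Q₀ e of λ ())
  onto′ : ∀ x → (P ∖ y) x ≡ true → (∃₂ λ i q → h (suc i) q ≡ x) ⊎ g x ≡ 𝟘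
  onto′ x P∖y∋x with ∖-elim P P∖y∋x
  ... | Px , x≢y with onto x Px
  ...   | inj₁ (zero , q , e) =
    ⊥-elim (x≢y (trans (sym e) (cong (h zero) (Decidable⇒UIP.≡-irrelevant Bool._≟_ q Q₀))))
  ...   | inj₁ (suc i , q , e) = inj₁ (i , q , e)
  ...   | inj₂ gx≡𝟘            = inj₂ gx≡𝟘

count-as-sum² : ∀ {m} (P : Subset m) → count P ≡ proj₁ (sum² P (λ _ → (1 , 0)))
count-as-sum² {zero}  P = refl
count-as-sum² {suc m} P with P zero
... | true  = cong suc (count-as-sum² (P ∘ suc))
... | false = count-as-sum² (P ∘ suc)

count-cong : ∀ {m} {P Q : Subset m} → (∀ x → P x ≡ Q x) → count P ≡ count Q
count-cong {P = P} {Q} P≗Q = begin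
  count P                            ≡⟨ count-as-sum² P ⟩
  proj₁ (sum² P (λ _ → (1 , 0)))     ≡⟨ cong proj₁ (sum²-congˢ _ P≗Q) ⟩
  proj₁ (sum² Q (λ _ → (1 , 0)))     ≡⟨ count-as-sum² Q ⟨
  count Q                            ∎
  where open ≡-Reasoning

count-remove : ∀ {m} (P : Subset m) {y} → P y ≡ true → count P ≡ suc (count (P ∖ y))
count-remove P {y} Py = begin
  count P                                 ≡⟨ count-as-sum² P ⟩
  proj₁ (sum² P (λ _ → (1 , 0)))          ≡⟨ cong proj₁ (sum²-remove P _ Py) ⟩
  suc (proj₁ (sum² (P ∖ y) (λ _ → (1 , 0)))) ≡⟨ cong suc (count-as-sum² (P ∖ y)) ⟨
  suc (count (P ∖ y))                     ∎
  where open ≡-Reasoning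

count-reindex : ∀ {m p} (P : Subset m) (Q : Subset p) (h : ∀ i → Q i ≡ true → Fin m) →
  (∀ i q → P (h i q) ≡ true) → (∀ i j q r → h i q ≡ h j r → i ≡ j) →
  (∀ x → P x ≡ true → ∃₂ λ i q → h i q ≡ x) →
  count P ≡ count Q
count-reindex P Q h h∈P h-inj onto = begin
  count P                         ≡⟨ count-as-sum² P ⟩
  proj₁ (sum² P (λ _ → (1 , 0)))  ≡⟨ cong proj₁ (sum²-reindex P _ Q _ h h∈P (λ _ _ → refl) h-inj
                                                  (λ x Px → inj₁ (onto x Px))) ⟩
  proj₁ (sum² Q (λ _ → (1 , 0)))  ≡⟨ count-as-sum² Q ⟨
  count Q                         ∎
  where open ≡-Reasoning

count-zero : ∀ {m} (P : Subset m) → (∀ x → P x ≡ false) → count P ≡ 0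
count-zero {zero}  P P≗∅ = refl
count-zero {suc m} P P≗∅ rewrite P≗∅ zero = count-zero (P ∘ suc) (P≗∅ ∘ suc)

count-≤ : ∀ {m} (P : Subset m) → count P ≤ m
count-≤ {zero}  P = z≤n
count-≤ {suc m} P with P zero
... | true  = s≤s (count-≤ (P ∘ suc))
... | false = m≤n⇒m≤1+n (count-≤ (P ∘ suc))

count-full : ∀ {m} → count (full {m}) ≡ m
count-full {zero}  = refl
count-full {suc m} = cong suc (count-full {m})

count-≥⇒all : ∀ {m} (P : Subset m) → m ≤ count P → ∀ x → P x ≡ true
count-≥⇒all {suc m} P m≤ x with P zero in P₀
count-≥⇒all {suc m} P m≤      zero    | true  = P₀
count-≥⇒all {suc m} P (s≤s m≤) (suc x) | true  = count-≥⇒all (P ∘ suc) m≤ x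
... | false = ⊥-elim (<⇒≱ (s≤s (count-≤ (P ∘ suc))) m≤)

count-injection : ∀ {m m′} (P : Subset m) (Q : Subset m′) (h : ∀ i → P i ≡ true → Fin m′) →
  (∀ i p → Q (h i p) ≡ true) → (∀ i j p q → h i p ≡ h j q → i ≡ j) →
  count P ≤ count Q
count-injection {zero}  P Q h h∈Q h-inj = z≤n
count-injection {suc m} P Q h h∈Q h-inj with P zero in P₀
... | false = count-injection (P ∘ suc) Q (h ∘ suc) (h∈Q ∘ suc) (tail-injective h h-inj)
... | true rewrite count-remove Q (h∈Q zero P₀) =
  s≤s (count-injection (P ∘ suc) (Q ∖ h zero P₀) (h ∘ suc) h∈Q∖h₀ (tail-injective h h-inj))
  where
  h∈Q∖h₀ : ∀ i p → (Q ∖ h zero P₀) (h (suc i) p) ≡ true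
  h∈Q∖h₀ i p = ∖-intro Q (h∈Q (suc i) p) (λ e → case h-inj (suc i) zero p P₀ e of λ ())

count-lift : ∀ {m m′} (π : Fin m′ → Fin m) (P : Subset m) (Q : Subset m′) →
  (∀ v → P v ≡ true → ∃[ y ] Q y ≡ true × π y ≡ v) → count P ≤ count Q
count-lift π P Q lift = count-injection P Q (λ v Pv → proj₁ (lift v Pv)) (λ v Pv → proj₁ (proj₂ (lift v Pv)))
  λ v w Pv Pw e → trans (sym (proj₂ (proj₂ (lift v Pv)))) (trans (cong π e) (proj₂ (proj₂ (lift w Pw))))

count-mono : ∀ {m} {P Q : Subset m} → (∀ x → P x ≡ true → Q x ≡ true) → count P ≤ count Q
count-mono {P = P} {Q} P⊆Q = count-injection P Q (λ x _ → x) P⊆Q (λ _ _ _ _ e → e)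

count-∃ : ∀ {m} (P : Subset m) → 0 < count P → ∃[ x ] P x ≡ true
count-∃ P 0<count with find P
... | inj₁ found = found
... | inj₂ P≗∅ = ⊥-elim (<-irrefl (sym (count-zero P P≗∅)) 0<count)

∈⇒count-pos : ∀ {m} (P : Subset m) {x} → P x ≡ true → 0 < count P
∈⇒count-pos P Px rewrite count-remove P Px = s≤s z≤n

count-singleton : ∀ {m} (P : Subset m) {x} → P x ≡ true → (∀ y → P y ≡ true → y ≡ x) → count P ≡ 1
count-singleton P {x} Px only-x =
  trans (count-remove P Px) (cong suc (count-zero (P ∖ x) none))
  where
  none : ∀ y → (P ∖ x) y ≡ false
  none y with (P ∖ x) y in e
  ... | false = refl
  ... | true  = ⊥-elim (proj₂ (∖-elim P e) (only-x y (proj₁ (∖-elim P e))))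

count≡1⇒unique : ∀ {m} (P : Subset m) → count P ≡ 1 →
  ∀ {x y} → P x ≡ true → P y ≡ true → x ≡ y
count≡1⇒unique P count≡1 {x} {y} Px Py with y ≟ x
... | yes y≡x = sym y≡x
... | no y≢x = ⊥-elim (<-irrefl (sym (suc-injective (trans (sym (count-remove P Px)) count≡1)))
                               (∈⇒count-pos (P ∖ x) (∖-intro P Py y≢x)))

count-∨-∧ : ∀ {m} (P Q : Subset m) →
  count (λ x → P x ∨ Q x) + count (λ x → P x ∧ Q x) ≡ count P + count Q
count-∨-∧ {zero}  P Q = refl
count-∨-∧ {suc m} P Q with P zero | Q zero | count-∨-∧ (P ∘ suc) (Q ∘ suc)
... | true  | true  | ih = cong suc (trans (+-suc _ _) (trans (cong suc ih) (sym (+-suc _ _))))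
... | true  | false | ih = cong suc ih
... | false | true  | ih = trans (cong suc ih) (sym (+-suc _ _))
... | false | false | ih = ih

count-disjoint-∨ : ∀ {m} (P Q : Subset m) → (∀ x → P x ∧ Q x ≡ false) →
  count (λ x → P x ∨ Q x) ≡ count P + count Q
count-disjoint-∨ P Q disjoint = begin
  count (λ x → P x ∨ Q x)                               ≡⟨ +-identityʳ _ ⟨
  count (λ x → P x ∨ Q x) + 0                           ≡⟨ cong (count (λ x → P x ∨ Q x) +_)
                                                                (count-zero _ disjoint) ⟨
  count (λ x → P x ∨ Q x) + count (λ x → P x ∧ Q x)     ≡⟨ count-∨-∧ P Q ⟩
  count P + count Q                                     ∎
  where open ≡-Reasoning

count-pair : ∀ {m} (P : Subset m) {a b} → a ≢ b → P a ≡ true → P b ≡ true →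
  (∀ x → P x ≡ true → x ≡ a ⊎ x ≡ b) → count P ≡ 2
count-pair P {a} {b} a≢b Pa Pb only-ab =
  trans (count-remove P Pa) (cong suc (count-singleton (P ∖ a) (∖-intro P Pb (a≢b ∘ sym)) only-b))
  where
  only-b : ∀ x → (P ∖ a) x ≡ true → x ≡ b
  only-b x P∖a∋x with ∖-elim P P∖a∋x
  ... | Px , x≢a with only-ab x Px
  ...   | inj₁ x≡a = ⊥-elim (x≢a x≡a)
  ...   | inj₂ x≡b = x≡b

image : ∀ {m₁ m} → (Fin m₁ → Fin m) → Subset m₁ → Subset m
image ψ S z = ⌊ Finₚ.any? (λ x → (S x Bool.≟ true) ×-dec (ψ x ≟ z)) ⌋

image-intro : ∀ {m₁ m} (ψ : Fin m₁ → Fin m) {S x} → S x ≡ true → image ψ S (ψ x) ≡ true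
image-intro ψ {S} {x} Sx = ⇒⌊⌋ (Finₚ.any? _) (x , Sx , refl)

image-elim : ∀ {m₁ m} (ψ : Fin m₁ → Fin m) {S z} → image ψ S z ≡ true → ∃[ x ] S x ≡ true × ψ x ≡ z
image-elim ψ e = ⌊⌋⇒ (Finₚ.any? _) e

count-image : ∀ {m₁ m} (ψ : Fin m₁ → Fin m) → Injective _≡_ _≡_ ψ → ∀ S → count (image ψ S) ≡ count S
count-image ψ ψ-inj S =
  count-reindex (image ψ S) S (λ x _ → ψ x) (λ _ Sx → image-intro ψ Sx) (λ _ _ _ _ → ψ-inj) onto
  where
  onto : ∀ z → image ψ S z ≡ true → ∃₂ λ x _ → ψ x ≡ z
  onto z z∈ with image-elim ψ z∈
  ... | x , Sx , ψx≡z = x , Sx , ψx≡z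

count-glued : ∀ {m m₁ m₂} {φ₁ : Fin m₁ → Fin m} {φ₂ : Fin m₂ → Fin m} →
  Injective _≡_ _≡_ φ₁ → Injective _≡_ _≡_ φ₂ → ∀ (R : Subset m) (R₁ : Subset m₁) (R₂ : Subset m₂) →
  (∀ {b b′} → R₁ b ≡ true → R₂ b′ ≡ true → φ₁ b ≢ φ₂ b′) →
  (∀ {w} → R w ≡ true → (∃[ b ] R₁ b ≡ true × φ₁ b ≡ w) ⊎ (∃[ b ] R₂ b ≡ true × φ₂ b ≡ w)) →
  (∀ {b} → R₁ b ≡ true → R (φ₁ b) ≡ true) → (∀ {b} → R₂ b ≡ true → R (φ₂ b) ≡ true) →
  count R ≡ count R₁ + count R₂
count-glued {φ₁ = φ₁} {φ₂} φ₁-inj φ₂-inj R R₁ R₂ apart split into₁ into₂ = begin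
  count R                                          ≡⟨ count-cong R≗images ⟩
  count (λ w → image φ₁ R₁ w ∨ image φ₂ R₂ w)      ≡⟨ count-disjoint-∨ _ _ disjoint ⟩
  count (image φ₁ R₁) + count (image φ₂ R₂)        ≡⟨ cong₂ _+_ (count-image φ₁ φ₁-inj R₁)
                                                                (count-image φ₂ φ₂-inj R₂) ⟩
  count R₁ + count R₂                              ∎
  where
  open ≡-Reasoning
  R≗images : ∀ w → R w ≡ image φ₁ R₁ w ∨ image φ₂ R₂ w
  R≗images w = ≡true-ext to from
    where
    to : R w ≡ true → image φ₁ R₁ w ∨ image φ₂ R₂ w ≡ true
    to Rw with split Rw
    ... | inj₁ (b , R₁b , refl) = ∨-introˡ _ (image-intro φ₁ R₁b)
    ... | inj₂ (b , R₂b , refl) = ∨-introʳ _ (image-intro φ₂ R₂b)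
    from : image φ₁ R₁ w ∨ image φ₂ R₂ w ≡ true → R w ≡ true
    from w∈ with ∨-true w∈
    ... | inj₁ w∈₁ with image-elim φ₁ w∈₁
    ...   | b , R₁b , refl = into₁ R₁b
    from w∈ | inj₂ w∈₂ with image-elim φ₂ w∈₂
    ...   | b , R₂b , refl = into₂ R₂b
  disjoint : ∀ w → image φ₁ R₁ w ∧ image φ₂ R₂ w ≡ false
  disjoint w = ∧-false λ w∈₁ w∈₂ → case image-elim φ₁ w∈₁ , image-elim φ₂ w∈₂ of λ
    { ((b , R₁b , φ₁b≡w) , (b′ , R₂b′ , φ₂b′≡w)) → apart R₁b R₂b′ (trans φ₁b≡w (sym φ₂b′≡w)) }

sumℕ-+ : ∀ {p} (a b : Fin p → ℕ) → sumℕ (λ i → a i + b i) ≡ sumℕ a + sumℕ b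
sumℕ-+ {zero}  a b = refl
sumℕ-+ {suc p} a b =
  trans (cong (a zero + b zero +_) (sumℕ-+ (a ∘ suc) (b ∘ suc))) (+-interchange (a zero) (b zero) _ _)

sumℕ-mono : ∀ {p} (a b : Fin p → ℕ) → (∀ i → a i ≤ b i) → sumℕ a ≤ sumℕ b
sumℕ-mono {zero}  a b a≤b = z≤n
sumℕ-mono {suc p} a b a≤b = +-mono-≤ (a≤b zero) (sumℕ-mono (a ∘ suc) (b ∘ suc) (a≤b ∘ suc))

sumℕ-< : ∀ {p} (a b : Fin p → ℕ) → sumℕ a < sumℕ b → ∃[ i ] a i < b i
sumℕ-< a b Σa<Σb with Finₚ.any? (λ i → a i <? b i)
... | yes found = found
... | no none = ⊥-elim (<⇒≱ Σa<Σb (sumℕ-mono b a λ i → ≮⇒≥ λ aᵢ<bᵢ → none (i , aᵢ<bᵢ)))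

count-fibres : ∀ {n p} (c : Fin n → Fin p) → sumℕ (λ i → count (λ v → ⌊ c v ≟ i ⌋)) ≡ n
count-fibres {zero}  {p} c = sumℕ-zero p
  where
  sumℕ-zero : ∀ p → sumℕ {p} (λ _ → 0) ≡ 0
  sumℕ-zero zero    = refl
  sumℕ-zero (suc p) = sumℕ-zero p
count-fibres {suc n} c = begin
  sumℕ (λ i → (if ⌊ c zero ≟ i ⌋ then 1 else 0) + count (λ v → ⌊ c (suc v) ≟ i ⌋))
    ≡⟨ sumℕ-+ (λ i → if ⌊ c zero ≟ i ⌋ then 1 else 0) _ ⟩
  count (λ i → ⌊ c zero ≟ i ⌋) + sumℕ (λ i → count (λ v → ⌊ c (suc v) ≟ i ⌋))
    ≡⟨ cong₂ _+_ (count-singleton _ (⇒⌊⌋ (c zero ≟ c zero) refl) (λ i e → sym (⌊⌋⇒ (c zero ≟ i) e)))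
                 (count-fibres (c ∘ suc)) ⟩
  suc n ∎
  where open ≡-Reasoning

sum²-full-diagonal : ∀ {p} (ns : Fin p → ℕ) → sum² full (λ i → (ns i , ns i)) ≡ (sumℕ ns , sumℕ ns)
sum²-full-diagonal {zero}  ns = refl
sum²-full-diagonal {suc p} ns rewrite sum²-full-diagonal (ns ∘ suc) = refl

-- Cycles

successor : ∀ {k} (i : Fin k) → ∃[ j ] CycAdj k i j
successor {suc k} i with suc (toℕ i) <? suc k
... | yes i+1<k = fromℕ< i+1<k , inj₁ (Finₚ.toℕ-fromℕ< i+1<k)
... | no  i+1≮k = zero , inj₂ (≤-antisym (Finₚ.toℕ<n i) (≮⇒≥ i+1≮k) , refl)

predecessor : ∀ {k} (j : Fin k) → ∃[ i ] CycAdj k i j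
predecessor {suc k} zero    = fromℕ< (n<1+n k) , inj₂ (cong suc (Finₚ.toℕ-fromℕ< (n<1+n k)) , refl)
predecessor {suc k} (suc j) = inject₁ j , inj₁ (cong suc (sym (Finₚ.toℕ-inject₁ j)))

next prev : ∀ {k} → Fin k → Fin k
next i = proj₁ (successor i)
prev j = proj₁ (predecessor j)

CycAdj-functional : ∀ {k} {i j j′ : Fin k} → CycAdj k i j → CycAdj k i j′ → j ≡ j′
CycAdj-functional (inj₁ j≡1+i) (inj₁ j′≡1+i) = Finₚ.toℕ-injective (trans j≡1+i (sym j′≡1+i))
CycAdj-functional {j = j} (inj₁ j≡1+i) (inj₂ (1+i≡k , _)) =
  ⊥-elim (<-irrefl (trans j≡1+i 1+i≡k) (Finₚ.toℕ<n j))
CycAdj-functional {j′ = j′} (inj₂ (1+i≡k , _)) (inj₁ j′≡1+i) =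
  ⊥-elim (<-irrefl (trans j′≡1+i 1+i≡k) (Finₚ.toℕ<n j′))
CycAdj-functional (inj₂ (_ , j≡0)) (inj₂ (_ , j′≡0)) = Finₚ.toℕ-injective (trans j≡0 (sym j′≡0))

CycAdj-injective : ∀ {k} {i i′ j : Fin k} → CycAdj k i j → CycAdj k i′ j → i ≡ i′
CycAdj-injective (inj₁ j≡1+i) (inj₁ j≡1+i′) = Finₚ.toℕ-injective (suc-injective (trans (sym j≡1+i) j≡1+i′))
CycAdj-injective (inj₁ j≡1+i) (inj₂ (_ , j≡0)) = case trans (sym j≡1+i) j≡0 of λ ()
CycAdj-injective (inj₂ (_ , j≡0)) (inj₁ j≡1+i′) = case trans (sym j≡0) j≡1+i′ of λ ()
CycAdj-injective (inj₂ (1+i≡k , _)) (inj₂ (1+i′≡k , _)) =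
  Finₚ.toℕ-injective (suc-injective (trans 1+i≡k (sym 1+i′≡k)))

CycAdj-asym : ∀ {k} {i j : Fin k} → 3 ≤ k → CycAdj k i j → ¬ CycAdj k j i
CycAdj-asym 3≤k (inj₁ j≡1+i) (inj₁ i≡1+j) = m≢1+n+m _ {1} (trans j≡1+i (cong suc i≡1+j))
CycAdj-asym 3≤k (inj₁ j≡1+i) (inj₂ (1+j≡k , i≡0)) =
  <⇒≱ (n<1+n 2) (subst (3 ≤_) (trans (sym 1+j≡k) (cong suc (trans j≡1+i (cong suc i≡0)))) 3≤k)
CycAdj-asym 3≤k (inj₂ (1+i≡k , j≡0)) (inj₁ i≡1+j) =
  <⇒≱ (n<1+n 2) (subst (3 ≤_) (trans (sym 1+i≡k) (cong suc (trans i≡1+j (cong suc j≡0)))) 3≤k)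
CycAdj-asym 3≤k (inj₂ (1+i≡k , j≡0)) (inj₂ (1+j≡k , _)) =
  <⇒≱ (n<1+n 2) (≤-trans (subst (3 ≤_) (trans (sym 1+j≡k) (cong suc j≡0)) 3≤k) (n≤1+n 1))

next-adj : ∀ {k} (i : Fin k) → CycAdj k i (next i)
next-adj i = proj₂ (successor i)

prev-adj : ∀ {k} (j : Fin k) → CycAdj k (prev j) j
prev-adj j = proj₂ (predecessor j)

next-prev : ∀ {k} (j : Fin k) → next (prev j) ≡ j
next-prev j = CycAdj-functional (next-adj (prev j)) (prev-adj j)

next-injective : ∀ {k} {i j : Fin k} → next i ≡ next j → i ≡ j
next-injective {j = j} e = CycAdj-injective (subst (CycAdj _ _) e (next-adj _)) (next-adj j)

alternating-on-steps : ∀ {k} (c : Fin k → Bool) → (∀ i → c (next i) ≡ not (c i)) →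
  ∀ i j → toℕ j ≡ suc (toℕ i) → c j ≡ not (c i)
alternating-on-steps c alternates i j j≡1+i =
  trans (cong c (CycAdj-functional (inj₁ j≡1+i) (next-adj i))) (alternates i)

SymAdj-sym : ∀ {k} {i j : Fin k} → SymAdj k i j → SymAdj k j i
SymAdj-sym (inj₁ i→j) = inj₂ i→j
SymAdj-sym (inj₂ j→i) = inj₁ j→i

count-cycle-neighbours : ∀ {m k} → 3 ≤ k → (σ : Fin k → Fin m) → Injective _≡_ _≡_ σ →
  (∀ x → ∃[ i ] σ i ≡ x) → ∀ i (R : Subset m) →
  (∀ j → (R (σ j) ≡ true) ⇔ SymAdj k i j) → count R ≡ 2
count-cycle-neighbours {k = k} 3≤k σ σ-inj σ-onto i R R≗adj =
  count-pair R σnext≢σprev (from (inj₁ (next-adj i))) (from (inj₂ (prev-adj i))) only-neighbours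
  where
  from : ∀ {j} → SymAdj k i j → R (σ j) ≡ true
  from = Equivalence.from (R≗adj _)
  σnext≢σprev : σ (next i) ≢ σ (prev i)
  σnext≢σprev e = CycAdj-asym 3≤k (next-adj i) (subst (λ j → CycAdj k j i) (sym (σ-inj e)) (prev-adj i))
  only-neighbours : ∀ x → R x ≡ true → x ≡ σ (next i) ⊎ x ≡ σ (prev i)
  only-neighbours x Rx with σ-onto x
  ... | j , refl with Equivalence.to (R≗adj j) Rx
  ...   | inj₁ i→j = inj₁ (cong σ (CycAdj-functional i→j (next-adj i)))
  ...   | inj₂ j→i = inj₂ (cong σ (CycAdj-injective j→i (prev-adj i)))

isOdd : ℕ → Bool
isOdd zero    = false
isOdd (suc n) = not (isOdd n)

isOdd-double : ∀ h → isOdd (h + h) ≡ false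
isOdd-double zero = refl
isOdd-double (suc h) rewrite +-suc h h | isOdd-double h = refl

CycAdj-isOdd : ∀ {k} {i j : Fin k} → Even k → CycAdj k i j → isOdd (toℕ j) ≡ not (isOdd (toℕ i))
CycAdj-isOdd _ (inj₁ j≡1+i) rewrite j≡1+i = refl
CycAdj-isOdd {i = i} {j} (h , k≡h+h) (inj₂ (1+i≡k , j≡0)) = begin
  isOdd (toℕ j)              ≡⟨ cong isOdd j≡0 ⟩
  false                      ≡⟨ isOdd-double h ⟨
  isOdd (h + h)              ≡⟨ cong isOdd (trans (sym k≡h+h) (sym 1+i≡k)) ⟩
  not (isOdd (toℕ i))        ∎
  where open ≡-Reasoning

SymAdj-isOdd : ∀ {k} {i j : Fin k} → Even k → SymAdj k i j → isOdd (toℕ j) ≡ not (isOdd (toℕ i))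
SymAdj-isOdd even (inj₁ i→j) = CycAdj-isOdd even i→j
SymAdj-isOdd even (inj₂ j→i) =
  trans (sym (not-involutive _)) (cong not (sym (CycAdj-isOdd even j→i)))

constant-by-steps : ∀ {a} {A : Set a} {k} (F : Fin k → A) →
  (∀ i j → toℕ j ≡ suc (toℕ i) → F j ≡ F i) → ∀ i j → F i ≡ F j
constant-by-steps {A = A} {k = suc k} F stable i j = trans (to-zero F stable i) (sym (to-zero F stable j))
  where
  to-zero : ∀ {k} (F : Fin (suc k) → A) → (∀ i j → toℕ j ≡ suc (toℕ i) → F j ≡ F i) →
    ∀ i → F i ≡ F zero
  to-zero F stable zero = refl
  to-zero {suc k} F stable (suc i) =
    trans (stable (inject₁ i) (suc i) (cong suc (sym (Finₚ.toℕ-inject₁ i))))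
          (to-zero (F ∘ inject₁) stable′ i)
    where
    stable′ : ∀ i j → toℕ j ≡ suc (toℕ i) → F (inject₁ j) ≡ F (inject₁ i)
    stable′ i j j≡1+i = stable (inject₁ i) (inject₁ j)
      (trans (Finₚ.toℕ-inject₁ j) (trans j≡1+i (cong suc (sym (Finₚ.toℕ-inject₁ i)))))

both-flip⇒xor-constant : ∀ {k} (c c′ : Fin k → Bool) → (∀ i j → toℕ j ≡ suc (toℕ i) → c j ≡ not (c i)) →
  (∀ i j → toℕ j ≡ suc (toℕ i) → c′ j ≡ not (c′ i)) → ∀ i j → c i xor c′ i ≡ c j xor c′ j
both-flip⇒xor-constant c c′ c-flips c′-flips = constant-by-steps (λ i → c i xor c′ i) stable
  where
  stable : ∀ i j → toℕ j ≡ suc (toℕ i) → c j xor c′ j ≡ c i xor c′ i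
  stable i j j≡1+i rewrite c-flips i j j≡1+i | c′-flips i j j≡1+i =
    trans (sym (not-distribˡ-xor (c i) (not (c′ i))))
          (trans (cong not (sym (not-distribʳ-xor (c i) (c′ i)))) (not-involutive _))

odd-cycle-not-alternating : ∀ {k} → Odd k → (c : Fin k → Bool) → ¬ (∀ i → c (next i) ≡ not (c i))
odd-cycle-not-alternating {k} (h , refl) c alternates =
  not-¬ refl (trans c-last≡c-zero (trans (cong c (sym wrap)) (alternates last)))
  where
  last : Fin k
  last = Fin.fromℕ (h + h)
  wrap : next last ≡ zero
  wrap = CycAdj-functional (next-adj last) (inj₂ (cong suc (Finₚ.toℕ-fromℕ (h + h)) , refl))
  c-last≡c-zero : c last ≡ c zero
  c-last≡c-zero = begin
    c last                              ≡⟨ xor-identityʳ (c last) ⟨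
    c last xor false                    ≡⟨ cong (c last xor_) (trans (sym (isOdd-double h))
                                             (cong isOdd (sym (Finₚ.toℕ-fromℕ (h + h))))) ⟩
    c last xor isOdd (toℕ last)         ≡⟨ both-flip⇒xor-constant c (isOdd ∘ toℕ)
                                             (alternating-on-steps c alternates)
                                             (λ i j j≡1+i → cong isOdd j≡1+i) last zero ⟩
    c zero xor false                    ≡⟨ xor-identityʳ (c zero) ⟩
    c zero                              ∎
    where open ≡-Reasoning

count-∘next : ∀ {k} (P : Subset k) → count (P ∘ next) ≡ count P
count-∘next P =
  sym (count-reindex P (P ∘ next) (λ j _ → next j) (λ _ P[next-j] → P[next-j])
                     (λ _ _ _ _ → next-injective) onto)
  where
  onto : ∀ x → P x ≡ true → ∃₂ λ j _ → next j ≡ x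
  onto x Px = prev x , subst (λ y → P y ≡ true) (sym (next-prev x)) Px , next-prev x

independent-half⇒alternating : ∀ {n} (P : Subset (n + n)) → n ≤ count P →
  (∀ j → P j ∧ P (next j) ≡ false) → ∀ j → P (next j) ≡ not (P j)
independent-half⇒alternating {n} P n≤|P| independent j = exactly-one (independent j) (covered j)
  where
  exactly-one : ∀ {a b} → a ∧ b ≡ false → a ∨ b ≡ true → b ≡ not a
  exactly-one {true}  a∧b≡false _ = a∧b≡false
  exactly-one {false} _ b≡true = b≡true
  covered : ∀ j → P j ∨ P (next j) ≡ true
  covered = count-≥⇒all _ (begin
    n + n                                ≤⟨ +-monoʳ-≤ n (subst (n ≤_) (sym (count-∘next P)) n≤|P|) ⟩
    n + count (P ∘ next)                 ≤⟨ +-monoˡ-≤ _ n≤|P| ⟩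
    count P + count (P ∘ next)           ≡⟨ count-disjoint-∨ P (P ∘ next) independent ⟨
    count (λ j → P j ∨ P (next j))       ∎)
    where open ≤-Reasoning

-- Transversals and obstructions

module Picking (C : Config) {T : Subset (size (H C))} (tr : Transversal C T) where

  private
    chosen : ∀ v → ∃[ x ] T x ∧ inX C v x ≡ true
    chosen v = count-∃ _ (subst (0 <_) (sym (tr v)) (s≤s z≤n))

  pick : Fin (size (D C)) → Fin (size (H C))
  pick v = proj₁ (chosen v)

  pick-∈ : ∀ v → T (pick v) ≡ true
  pick-∈ v = proj₁ (∧-true (proj₂ (chosen v)))

  X-pick : ∀ v → X C (pick v) ≡ v
  X-pick v = ⌊⌋⇒ (X C (pick v) ≟ v) (proj₂ (∧-true (proj₂ (chosen v))))

  unique : ∀ {x y} → T x ≡ true → T y ≡ true → X C x ≡ X C y → x ≡ y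
  unique {x} {y} Tx Ty Xx≡Xy = count≡1⇒unique (λ z → T z ∧ inX C (X C y) z) (tr (X C y))
    (∧-intro Tx (⇒⌊⌋ (X C x ≟ X C y) Xx≡Xy)) (∧-intro Ty (⇒⌊⌋ (X C y ≟ X C y) refl))

  pick-X : ∀ {x} → T x ≡ true → pick (X C x) ≡ x
  pick-X Tx = unique (pick-∈ _) Tx (X-pick _)

saturated-arc : ∀ C {T} → Transversal C T → Saturated C T → ∀ {x y} → T x ≡ true → T y ≡ true →
  arc (D C) (X C x) (X C y) ≡ true → arc (H C) x y ≡ true
saturated-arc C tr sat {x} {y} Tx Ty Xx→Xy
  with proj₁ (sat (X C x) (X C y) Xx→Xy (x , Tx , refl) (y , Ty , refl)) x Tx refl
... | y′ , Ty′ , Xy′≡Xy , x→y′ = subst (λ z → arc (H C) x z ≡ true) (Picking.unique C tr Ty′ Ty Xy′≡Xy) x→y′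

degWithin : (G : Digraph) → Subset (size G) → Fin (size G) → ℕ²
degWithin G S x = count (λ y → S y ∧ arc G x y) , count (λ y → S y ∧ arc G y x)

infix 4 _≤²_
_≤²_ : ℕ² → ℕ² → Set
p ≤² q = proj₁ p ≤ proj₁ q × proj₂ p ≤ proj₂ q

≤²-trans : ∀ {p q r} → p ≤² q → q ≤² r → p ≤² r
≤²-trans (p₁≤q₁ , p₂≤q₂) (q₁≤r₁ , q₂≤r₂) = ≤-trans p₁≤q₁ q₁≤r₁ , ≤-trans p₂≤q₂ q₂≤r₂

⊕-mono-≤² : ∀ {p q r s} → p ≤² q → r ≤² s → p ⊕ r ≤² q ⊕ s
⊕-mono-≤² (p₁≤q₁ , p₂≤q₂) (r₁≤s₁ , r₂≤s₂) = +-mono-≤ p₁≤q₁ r₁≤s₁ , +-mono-≤ p₂≤q₂ r₂≤s₂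

degWithin-mono : ∀ G {S S′} → (∀ y → S y ≡ true → S′ y ≡ true) → ∀ x → degWithin G S x ≤² degWithin G S′ x
degWithin-mono G {S} {S′} S⊆S′ x = count-mono (restrict (arc G x)) , count-mono (restrict (λ y → arc G y x))
  where
  restrict : ∀ (R : Subset (size G)) y → S y ∧ R y ≡ true → S′ y ∧ R y ≡ true
  restrict R y e with ∧-true e
  ... | Sy , Ry = ∧-intro (S⊆S′ y Sy) Ry

degWithin-image : ∀ {G₁ G} (ψ : Fin (size G₁) → Fin (size G)) → Injective _≡_ _≡_ ψ →
  (∀ {x y} → arc G₁ x y ≡ true → arc G (ψ x) (ψ y) ≡ true) →
  ∀ S x → degWithin G₁ S x ≤² degWithin G (image ψ S) (ψ x)
degWithin-image ψ ψ-inj ψ-arc S x =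
  count-injection _ _ (λ y _ → ψ y) (λ y e → into (∧-true e) ψ-arc) (λ _ _ _ _ → ψ-inj) ,
  count-injection _ _ (λ y _ → ψ y) (λ y e → into (∧-true e) ψ-arc) (λ _ _ _ _ → ψ-inj)
  where
  into : ∀ {y a b} → S y ≡ true × a ≡ true → (a ≡ true → b ≡ true) → image ψ S (ψ y) ∧ b ≡ true
  into (Sy , a) a⇒b = ∧-intro (image-intro ψ Sy) (a⇒b a)

degWithin-∨ : ∀ G {S S′ x} → (∀ y → S y ≡ true → S′ y ≡ true → y ≡ x) →
  degWithin G (λ y → S y ∨ S′ y) x ≡ degWithin G S x ⊕ degWithin G S′ x
degWithin-∨ G {S} {S′} {x} meet-at-x =
  cong₂ _,_ (split (arc G x) (loopless G x)) (split (λ y → arc G y x) (loopless G x))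
  where
  split : ∀ (R : Subset (size G)) → R x ≡ false →
    count (λ y → (S y ∨ S′ y) ∧ R y) ≡ count (λ y → S y ∧ R y) + count (λ y → S′ y ∧ R y)
  split R Rx≡false = trans (count-cong λ y → ∧-distribʳ-∨ (R y) (S y) (S′ y))
                           (count-disjoint-∨ _ _ λ y → ∧-false (not-both y))
    where
    not-both : ∀ y → S y ∧ R y ≡ true → S′ y ∧ R y ≡ true → ⊥
    not-both y SyRy S′yRy with ∧-true SyRy | ∧-true S′yRy
    ... | Sy , Ry | S′y , _ = not-¬ Ry (subst (λ y → R y ≡ false) (sym (meet-at-x y Sy S′y)) Rx≡false)

-- The induced subdigraph H[S] witnesses that H[T] is not strictly f-degenerate.
record Obstruction (C : Config) (T : Subset (size (H C))) : Set where
  field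
    S        : Subset (size (H C))
    S⊆T      : ∀ x → S x ≡ true → T x ≡ true
    nonempty : ∃[ x ] S x ≡ true
    heavy    : ∀ x → S x ≡ true → f C x ≤² degWithin (H C) S x

Obstructed : Config → Set
Obstructed C = ∀ T → Transversal C T → Obstruction C T

obstruction⇒¬degenerate : ∀ {C T} → Obstruction C T → ¬ StrictlyDegenerate C T
obstruction⇒¬degenerate {C} O degenerate = refute (degenerate S B S⊆T B-induced nonempty)
  where
  open Obstruction O
  B : Fin (size (H C)) → Fin (size (H C)) → Bool
  B x y = S x ∧ (S y ∧ arc (H C) x y)
  B-induced : ∀ x y → B x y ≡ true → arc (H C) x y ≡ true × S x ≡ true × S y ≡ true
  B-induced x y e with ∧-true e
  ... | Sx , e′ with ∧-true e′
  ...   | Sy , x→y = x→y , Sx , Sy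
  refute : ¬ (∃[ x ] (S x ≡ true ×
                      (count (B x) < proj₁ (f C x) ⊎ count (λ y → B y x) < proj₂ (f C x))))
  refute (x , Sx , inj₁ out<) = <⇒≱ out< (≤-trans (proj₁ (heavy x Sx))
    (≤-reflexive (count-cong λ y → cong (_∧ (S y ∧ arc (H C) x y)) (sym Sx))))
  refute (x , Sx , inj₂ in<) = <⇒≱ in< (≤-trans (proj₂ (heavy x Sx))
    (≤-reflexive (count-cong λ y → cong (λ b → S y ∧ (b ∧ arc (H C) y x)) (sym Sx))))

obstructed⇒uncolorable : ∀ {C} → Obstructed C → ¬ Colorable C
obstructed⇒uncolorable obstructed (T , tr , degenerate) =
  obstruction⇒¬degenerate (obstructed T tr) degenerate

obstruction-or-nonzero : ∀ C T → Obstruction C T ⊎ (∀ x → T x ≡ true → f C x ≢ 𝟘)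
obstruction-or-nonzero C T
  with Finₚ.any? (λ x → (T x Bool.≟ true) ×-dec Productₚ.≡-dec _≟ℕ_ _≟ℕ_ (f C x) 𝟘)
... | no ¬zero = inj₂ λ x Tx fx≡𝟘 → ¬zero (x , Tx , fx≡𝟘)
... | yes (x , Tx , fx≡𝟘) = inj₁ record
  { S = λ z → ⌊ z ≟ x ⌋
  ; S⊆T = λ z z≡x → subst (λ z → T z ≡ true) (sym (⌊⌋⇒ (z ≟ x) z≡x)) Tx
  ; nonempty = x , ⇒⌊⌋ (x ≟ x) refl
  ; heavy = λ z z≡x → subst (_≤² _) (sym (trans (cong (f C) (⌊⌋⇒ (z ≟ x) z≡x)) fx≡𝟘)) (z≤n , z≤n) }

obstructed-by : ∀ C → (∀ {T} → Transversal C T → (∀ x → T x ≡ true → f C x ≢ 𝟘) → Obstruction C T) →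
  Obstructed C
obstructed-by C obstruction T tr with obstruction-or-nonzero C T
... | inj₁ O       = O
... | inj₂ nonzero = obstruction tr nonzero

nonzero⇒∈ : ∀ {A : Set} {m} (P : Subset m) (g : Fin m → A) {a} →
  (∀ x → P x ≡ false → g x ≡ a) → ∀ {x} → g x ≢ a → P x ≡ true
nonzero⇒∈ P g outside {x} gx≢a with P x in Px
... | true  = refl
... | false = ⊥-elim (gx≢a (outside x Px))

pair : ∀ {m} → Fin m → Fin m → Subset m
pair a b z = ⌊ z ≟ a ⌋ ∨ ⌊ z ≟ b ⌋

module _ (C : Config) {T : Subset (size (H C))} {a b : Fin (size (H C))}
         (Ta : T a ≡ true) (Tb : T b ≡ true) where

  private
    a∈ : pair a b a ≡ true
    a∈ = ∨-introˡ _ (⇒⌊⌋ (a ≟ a) refl)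
    b∈ : pair a b b ≡ true
    b∈ = ∨-introʳ ⌊ b ≟ a ⌋ (⇒⌊⌋ (b ≟ b) refl)
    pair⊆T : ∀ z → pair a b z ≡ true → T z ≡ true
    pair⊆T z z∈ with ∨-true z∈
    ... | inj₁ z≡a = subst (λ z → T z ≡ true) (sym (⌊⌋⇒ (z ≟ a) z≡a)) Ta
    ... | inj₂ z≡b = subst (λ z → T z ≡ true) (sym (⌊⌋⇒ (z ≟ b) z≡b)) Tb
    out-pos : ∀ {x y} → pair a b y ≡ true → arc (H C) x y ≡ true → 0 < proj₁ (degWithin (H C) (pair a b) x)
    out-pos {x} y∈ x→y = ∈⇒count-pos (λ y → pair a b y ∧ arc (H C) x y) (∧-intro y∈ x→y)
    in-pos : ∀ {x y} → pair a b y ≡ true → arc (H C) y x ≡ true → 0 < proj₂ (degWithin (H C) (pair a b) x)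
    in-pos {x} y∈ y→x = ∈⇒count-pos (λ y → pair a b y ∧ arc (H C) y x) (∧-intro y∈ y→x)
    pair-obstruction : f C a ≤² degWithin (H C) (pair a b) a → f C b ≤² degWithin (H C) (pair a b) b →
      Obstruction C T
    pair-obstruction a-heavy b-heavy = record
      { S = pair a b ; S⊆T = pair⊆T ; nonempty = a , a∈ ; heavy = heavy }
      where
      heavy : ∀ z → pair a b z ≡ true → f C z ≤² degWithin (H C) (pair a b) z
      heavy z z∈ with ∨-true z∈
      ... | inj₁ z≡a rewrite ⌊⌋⇒ (z ≟ a) z≡a = a-heavy
      ... | inj₂ z≡b rewrite ⌊⌋⇒ (z ≟ b) z≡b = b-heavy

  digon-obstruction : arc (H C) a b ≡ true → arc (H C) b a ≡ true →
    f C a ≡ (1 , 1) → f C b ≡ (1 , 1) → Obstruction C T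
  digon-obstruction a→b b→a fa fb = pair-obstruction
    (subst (_≤² _) (sym fa) (out-pos b∈ a→b , in-pos b∈ b→a))
    (subst (_≤² _) (sym fb) (out-pos a∈ b→a , in-pos a∈ a→b))

  arc-obstruction : arc (H C) a b ≡ true → f C a ≡ (1 , 0) → f C b ≡ (0 , 1) → Obstruction C T
  arc-obstruction a→b fa fb = pair-obstruction
    (subst (_≤² _) (sym fa) (out-pos b∈ a→b , z≤n))
    (subst (_≤² _) (sym fb) (z≤n , in-pos a∈ a→b))

saturated-degWithin : ∀ C {T} → Transversal C T → Saturated C T →
  ∀ {S} → (∀ x → S x ≡ true → T x ≡ true) →
  (W : Subset (size (D C))) → (∀ v → W v ≡ true → ∃[ y ] S y ≡ true × X C y ≡ v) →
  ∀ {x} → S x ≡ true → degWithin (D C) W (X C x) ≤² degWithin (H C) S x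
saturated-degWithin C tr sat {S} S⊆T W lift {x} Sx =
  count-lift (X C) _ _ (λ v p → out (∧-true {W v} p)) , count-lift (X C) _ _ (λ v p → in′ (∧-true {W v} p))
  where
  lifted-arc : ∀ {y z} → S y ≡ true → S z ≡ true → arc (D C) (X C y) (X C z) ≡ true → arc (H C) y z ≡ true
  lifted-arc Sy Sz = saturated-arc C tr sat (S⊆T _ Sy) (S⊆T _ Sz)
  out : ∀ {v} → W v ≡ true × arc (D C) (X C x) v ≡ true →
    ∃[ y ] S y ∧ arc (H C) x y ≡ true × X C y ≡ v
  out {v} (Wv , Xx→v) with lift v Wv
  ... | y , Sy , refl = y , ∧-intro Sy (lifted-arc Sx Sy Xx→v) , refl
  in′ : ∀ {v} → W v ≡ true × arc (D C) v (X C x) ≡ true →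
    ∃[ y ] S y ∧ arc (H C) y x ≡ true × X C y ≡ v
  in′ {v} (Wv , v→Xx) with lift v Wv
  ... | y , Sy , refl = y , ∧-intro Sy (lifted-arc Sy Sx v→Xx) , refl

Balanced : Config → Set
Balanced C = ∀ v → sum² (inX C v) (f C) ≡ deg (D C) v

fibre-sum : ∀ C {p} (Ts : Fin p → Subset (size (H C))) →
  (∀ i j x → Ts i x ≡ true → Ts j x ≡ true → i ≡ j) → (tr : ∀ i → Transversal C (Ts i)) →
  (∀ x → (∀ i → Ts i x ≡ false) → f C x ≡ 𝟘) →
  ∀ v → sum² (inX C v) (f C) ≡ sum² full (λ i → f C (Picking.pick C (tr i) v))
fibre-sum C Ts disjoint tr outside v =
  sum²-reindex (inX C v) (f C) full _ (λ i _ → pick i) (λ i _ → ⇒⌊⌋ (X C (pick i) ≟ v) (X-pick i))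
    (λ _ _ → refl) (λ i j _ _ → pick-injective i j) onto
  where
  pick : ∀ i → Fin (size (H C))
  pick i = Picking.pick C (tr i) v
  pick-∈ : ∀ i → Ts i (pick i) ≡ true
  pick-∈ i = Picking.pick-∈ C (tr i) v
  X-pick : ∀ i → X C (pick i) ≡ v
  X-pick i = Picking.X-pick C (tr i) v
  pick-injective : ∀ i j → pick i ≡ pick j → i ≡ j
  pick-injective i j e = disjoint i j (pick i) (pick-∈ i) (subst (λ x → Ts j x ≡ true) (sym e) (pick-∈ j))
  onto : ∀ x → inX C v x ≡ true → (∃₂ λ i _ → pick i ≡ x) ⊎ f C x ≡ 𝟘
  onto x x∈Xv with find (λ i → Ts i x)
  ... | inj₂ none = inj₂ (outside x none)
  ... | inj₁ (i , x∈Ts) =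
    inj₁ (i , refl , Picking.unique C (tr i) (pick-∈ i) x∈Ts (trans (X-pick i) (sym (⌊⌋⇒ (X C x ≟ v) x∈Xv))))

fibre-sum₁ : ∀ C {T} (tr : Transversal C T) → (∀ x → T x ≡ false → f C x ≡ 𝟘) →
  ∀ v → sum² (inX C v) (f C) ≡ f C (Picking.pick C tr v)
fibre-sum₁ C {T} tr outside v =
  trans (fibre-sum C {1} (λ _ → T) one-class (λ _ → tr) outside′ v) (⊕-identityʳ _)
  where
  one-class : ∀ i j x → T x ≡ true → T x ≡ true → i ≡ j
  one-class zero zero _ _ _ = refl
  outside′ : ∀ x → (∀ (i : Fin 1) → T x ≡ false) → f C x ≡ 𝟘
  outside′ x none = outside x (none zero)

degWithin-complete : ∀ G → IsCompleteSym G → ∀ W u → degWithin G W u ≡ (count (W ∖ u) , count (W ∖ u))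
degWithin-complete G (_ , arc⇔≢) W u = cong₂ _,_ (count-cong out) (count-cong in′)
  where
  out : ∀ w → W w ∧ arc G u w ≡ (W ∖ u) w
  out w with w ≟ u
  ... | yes refl = trans (cong (W w ∧_) (loopless G w)) (∧-zeroʳ (W w))
  ... | no w≢u   = trans (cong (W w ∧_) (Equivalence.from (arc⇔≢ u w) (w≢u ∘ sym))) (∧-identityʳ (W w))
  in′ : ∀ w → W w ∧ arc G w u ≡ (W ∖ u) w
  in′ w with w ≟ u
  ... | yes refl = trans (cong (W w ∧_) (loopless G w)) (∧-zeroʳ (W w))
  ... | no w≢u   = trans (cong (W w ∧_) (Equivalence.from (arc⇔≢ w u) w≢u)) (∧-identityʳ (W w))

record UnderlyingCycle (G : Digraph) (S : Subset (size G)) (k : ℕ) : Set where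
  field
    vertex    : Fin k → Fin (size G)
    injective : Injective _≡_ _≡_ vertex
    spans     : ∀ x → (S x ≡ true) ⇔ (∃[ i ] vertex i ≡ x)
    adjacent  : ∀ i j → ((arc G (vertex i) (vertex j) ∨ arc G (vertex j) (vertex i)) ≡ true) ⇔ SymAdj k i j

symmetric⇒underlying : ∀ {G S k} → InducedSymCycle G S k → UnderlyingCycle G S k
symmetric⇒underlying {G} {k = k} (σ , σ-inj , spans , adj) = record
  { vertex = σ ; injective = σ-inj ; spans = spans
  ; adjacent = λ i j → mk⇔ (to i j) (∨-introˡ _ ∘ Equivalence.from (adj i j)) }
  where
  to : ∀ i j → (arc G (σ i) (σ j) ∨ arc G (σ j) (σ i)) ≡ true → SymAdj k i j
  to i j e with ∨-true e
  ... | inj₁ i→j = Equivalence.to (adj i j) i→j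
  ... | inj₂ j→i = SymAdj-sym (Equivalence.to (adj j i) j→i)

antidirected⇒underlying : ∀ {G S k} → InducedAntiCycle G S k → UnderlyingCycle G S k
antidirected⇒underlying (σ , σ-inj , spans , adj , _) =
  record { vertex = σ ; injective = σ-inj ; spans = spans ; adjacent = adj }

deg-symmetric-cycle : ∀ G → InducedSymCycle G full (size G) → 3 ≤ size G → ∀ v → deg G v ≡ (2 , 2)
deg-symmetric-cycle G (σ , σ-inj , spans , adj) 3≤k v with Equivalence.to (spans v) refl
... | i , refl = cong₂ _,_
  (count-cycle-neighbours 3≤k σ σ-inj onto i (arc G (σ i)) (adj i))
  (count-cycle-neighbours 3≤k σ σ-inj onto i (λ x → arc G x (σ i))
     λ j → mk⇔ (SymAdj-sym ∘ Equivalence.to (adj j i)) (Equivalence.from (adj j i) ∘ SymAdj-sym))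
  where
  onto : ∀ x → ∃[ i ] σ i ≡ x
  onto x = Equivalence.to (spans x) refl

module _ (G : Digraph) (cycle : InducedAntiCycle G full (size G)) where

  private
    open UnderlyingCycle (antidirected⇒underlying {G} cycle)
      renaming (vertex to σ; injective to σ-inj; adjacent to adj)
    source-or-sink : ∀ i → (∀ j → arc G (σ j) (σ i) ≡ false) ⊎ (∀ j → arc G (σ i) (σ j) ≡ false)
    source-or-sink = proj₂ (proj₂ (proj₂ (proj₂ cycle)))
    onto : ∀ x → ∃[ i ] σ i ≡ x
    onto x = Equivalence.to (spans x) refl

  antidirected-source-or-sink : ∀ v → IsSource G v ⊎ IsSink G v
  antidirected-source-or-sink v with onto v
  ... | i , refl with source-or-sink i
  ...   | inj₁ source =
    inj₁ λ w → subst (λ w → arc G w (σ i) ≡ false) (proj₂ (onto w)) (source (proj₁ (onto w)))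
  ...   | inj₂ sink   =
    inj₂ λ w → subst (λ w → arc G (σ i) w ≡ false) (proj₂ (onto w)) (sink (proj₁ (onto w)))

  deg-antidirected-source : 3 ≤ size G → ∀ v → IsSource G v → deg G v ≡ (2 , 0)
  deg-antidirected-source 3≤k v source with onto v
  ... | i , refl = cong₂ _,_
    (count-cycle-neighbours 3≤k σ σ-inj onto i (arc G (σ i))
       λ j → subst (λ b → (b ≡ true) ⇔ SymAdj _ i j) (ignore-in j) (adj i j))
    (count-zero _ source)
    where
    ignore-in : ∀ j → arc G (σ i) (σ j) ∨ arc G (σ j) (σ i) ≡ arc G (σ i) (σ j)
    ignore-in j rewrite source (σ j) = ∨-identityʳ _

  deg-antidirected-sink : 3 ≤ size G → ∀ v → IsSink G v → deg G v ≡ (0 , 2)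
  deg-antidirected-sink 3≤k v sink with onto v
  ... | i , refl = cong₂ _,_
    (count-zero _ sink)
    (count-cycle-neighbours 3≤k σ σ-inj onto i (λ x → arc G x (σ i))
       λ j → subst (λ b → (b ≡ true) ⇔ SymAdj _ i j) (ignore-out j) (adj i j))
    where
    ignore-out : ∀ j → arc G (σ i) (σ j) ∨ arc G (σ j) (σ i) ≡ arc G (σ j) (σ i)
    ignore-out j rewrite sink (σ j) = refl

arc-projects : ∀ C {x y} → arc (H C) x y ≡ true → arc (D C) (X C x) (X C y) ≡ true
arc-projects C {x} {y} x→y =
  IsCover.noArc (cover C) x y x→y (λ Xx≡Xy → not-¬ x→y (IsCover.independent (cover C) x y Xx≡Xy))

module DoubleCover (C : Config) (even : Even (size (D C))) (2≤n : 2 ≤ size (D C))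
  (base : UnderlyingCycle (D C) full (size (D C)))
  {U : Subset (size (H C))} (double-cycle : UnderlyingCycle (H C) U (size (D C) + size (D C)))
  {T : Subset (size (H C))} (tr : Transversal C T) (T⊆U : ∀ x → T x ≡ true → U x ≡ true) where

  private
    n : ℕ
    n = size (D C)
    open Picking C tr
    open UnderlyingCycle base using ()
      renaming (vertex to σ; injective to σ-injective; spans to σ-spans; adjacent to σ-adjacent)
    open UnderlyingCycle double-cycle using () renaming (vertex to τ; spans to τ-spans; adjacent to τ-adjacent)

    P : Subset (n + n)
    P j = T (τ j)

    position : Fin n → Fin (n + n)
    position v = proj₁ (Equivalence.to (τ-spans (pick v)) (T⊆U _ (pick-∈ v)))

    X-τ-position : ∀ v → X C (τ (position v)) ≡ v
    X-τ-position v = trans (cong (X C) (proj₂ (Equivalence.to (τ-spans (pick v)) _))) (X-pick v)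

    P-position : ∀ v → P (position v) ≡ true
    P-position v = subst (λ x → T x ≡ true) (sym (proj₂ (Equivalence.to (τ-spans (pick v)) _))) (pick-∈ v)

    n≤|P| : n ≤ count P
    n≤|P| = subst (_≤ count P) (count-full {n})
      (count-lift (X C ∘ τ) full P λ v _ → position v , P-position v , X-τ-position v)

    index : Fin (n + n) → Fin n
    index j = proj₁ (Equivalence.to (σ-spans (X C (τ j))) refl)

    σ-index : ∀ j → σ (index j) ≡ X C (τ j)
    σ-index j = proj₂ (Equivalence.to (σ-spans (X C (τ j))) refl)

    index-position : ∀ v → index (position (σ v)) ≡ v
    index-position v = σ-injective (trans (σ-index _) (X-τ-position (σ v)))

    index-adjacent : ∀ j → SymAdj n (index j) (index (next j))
    index-adjacent j = Equivalence.to (σ-adjacent _ _) (subst₂ (λ u w → (arc (D C) u w ∨ arc (D C) w u) ≡ true)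
      (sym (σ-index j)) (sym (σ-index (next j))) projected)
      where
      projected : (arc (D C) (X C (τ j)) (X C (τ (next j))) ∨ arc (D C) (X C (τ (next j))) (X C (τ j))) ≡ true
      projected with ∨-true (Equivalence.from (τ-adjacent j (next j)) (inj₁ (next-adj j)))
      ... | inj₁ forward  = ∨-introˡ _ (arc-projects C forward)
      ... | inj₂ backward = ∨-introʳ _ (arc-projects C backward)

    -- An independent transversal occupies every second vertex of the 2n-cycle, and so does each
    -- parity class of the D-index (n is even); hence T-membership and index parity agree up to a
    -- constant along the cycle.  But the T-vertices over σ 0 and σ 1 have indices of different parity.
    no-independent-transversal : ¬ (∀ j → P j ∧ P (next j) ≡ false)
    no-independent-transversal independent = case true≡false of λ ()
      where
      F : Fin (n + n) → Bool
      F j = P j xor isOdd (toℕ (index j))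
      F-constant : ∀ i j → F i ≡ F j
      F-constant = both-flip⇒xor-constant P (isOdd ∘ toℕ ∘ index)
        (alternating-on-steps P (independent-half⇒alternating P n≤|P| independent))
        (alternating-on-steps (isOdd ∘ toℕ ∘ index) (λ j → SymAdj-isOdd even (index-adjacent j)))
      F-over : ∀ v → F (position (σ v)) ≡ not (isOdd (toℕ v))
      F-over v rewrite P-position (σ v) | index-position v = refl
      0<n : 0 < n
      0<n = ≤-trans (s≤s z≤n) 2≤n
      true≡false : true ≡ false
      true≡false = begin
        true                           ≡⟨ cong (not ∘ isOdd) (Finₚ.toℕ-fromℕ< 0<n) ⟨
        not (isOdd (toℕ (fromℕ< 0<n))) ≡⟨ F-over _ ⟨
        F (position (σ (fromℕ< 0<n)))  ≡⟨ F-constant _ _ ⟩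
        F (position (σ (fromℕ< 2≤n)))  ≡⟨ F-over _ ⟩
        not (isOdd (toℕ (fromℕ< 2≤n))) ≡⟨ cong (not ∘ isOdd) (Finₚ.toℕ-fromℕ< 2≤n) ⟩
        false                          ∎
        where open ≡-Reasoning

  consecutive : ∃[ j ] T (τ j) ≡ true × T (τ (next j)) ≡ true
  consecutive with find (λ j → P j ∧ P (next j))
  ... | inj₁ (j , both) = j , ∧-true both
  ... | inj₂ independent = ⊥-elim (no-independent-transversal independent)

-- The base configurations (I)–(V)

module _ (C : Config) {T : Subset (size (H C))} (tr : Transversal C T)
         (f-on : ∀ x → T x ≡ true → f C x ≡ deg (D C) (X C x)) (f-off : ∀ x → T x ≡ false → f C x ≡ 𝟘) where

  balanced-I : Balanced C
  balanced-I v = trans (fibre-sum₁ C tr f-off v) (trans (f-on _ (pick-∈ v)) (cong (deg (D C)) (X-pick v)))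
    where open Picking C tr

  module _ (sat : Saturated C T) {T′ : Subset (size (H C))} (tr′ : Transversal C T′)
           (nonzero : ∀ x → T′ x ≡ true → f C x ≢ 𝟘) where

    private
      open Picking C tr′ renaming (pick to pick′; pick-∈ to pick′-∈; X-pick to X-pick′)

      T′⊆T : ∀ x → T′ x ≡ true → T x ≡ true
      T′⊆T x T′x = nonzero⇒∈ T (f C) f-off (nonzero x T′x)

    transversal-obstruction : 0 < size (D C) → Obstruction C T′
    transversal-obstruction 0<n = record
      { S = T′ ; S⊆T = λ _ T′x → T′x ; nonempty = pick′ (fromℕ< 0<n) , pick′-∈ _ ; heavy = heavy }
      where
      heavy : ∀ x → T′ x ≡ true → f C x ≤² degWithin (H C) T′ x
      heavy x T′x = subst (_≤² degWithin (H C) T′ x) (sym (f-on x (T′⊆T x T′x)))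
        (saturated-degWithin C tr sat T′⊆T full (λ v _ → pick′ v , pick′-∈ v , X-pick′ v) T′x)

  obstructed-I : 0 < size (D C) → Saturated C T → Obstructed C
  obstructed-I 0<n sat = obstructed-by C λ tr′ nonzero → transversal-obstruction sat tr′ nonzero 0<n

module _ (C : Config) (complete : IsCompleteSym (D C)) {p} (ns : Fin p → ℕ)
         (Σns : sumℕ ns ≡ size (D C) ∸ 1) (Ts : Fin p → Subset (size (H C)))
         (disjoint : ∀ i j x → Ts i x ≡ true → Ts j x ≡ true → i ≡ j)
         (tr : ∀ i → Transversal C (Ts i))
         (f-on : ∀ i x → Ts i x ≡ true → f C x ≡ (ns i , ns i))
         (f-off : ∀ x → (∀ i → Ts i x ≡ false) → f C x ≡ 𝟘) where

  private
    n : ℕ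
    n = size (D C)

  balanced-II : Balanced C
  balanced-II v = begin
    sum² (inX C v) (f C)                               ≡⟨ fibre-sum C Ts disjoint tr f-off v ⟩
    sum² full (λ i → f C (Picking.pick C (tr i) v))    ≡⟨ sum²-cong full (λ i _ →
                                                            f-on i _ (Picking.pick-∈ C (tr i) v)) ⟩
    sum² full (λ i → (ns i , ns i))                    ≡⟨ sum²-full-diagonal ns ⟩
    (sumℕ ns , sumℕ ns)                                ≡⟨ cong (λ s → s , s) Σns ⟩
    (n ∸ 1 , n ∸ 1)                                    ≡⟨ cong (λ s → s ∸ 1 , s ∸ 1)
                                                            (trans (sym (count-full {n}))
                                                                   (count-remove full {v} refl)) ⟩
    (count (full ∖ v) , count (full ∖ v))              ≡⟨ degWithin-complete (D C) complete full v ⟨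
    deg (D C) v                                        ∎
    where open ≡-Reasoning

  module _ (sat : ∀ i → Saturated C (Ts i)) {T′ : Subset (size (H C))} (tr′ : Transversal C T′)
           (nonzero : ∀ x → T′ x ≡ true → f C x ≢ 𝟘) where

    private
      open Picking C tr′ renaming (pick to pick′; pick-∈ to pick′-∈; X-pick to X-pick′; pick-X to pick′-X)

      class-of : ∀ v → ∃[ i ] Ts i (pick′ v) ≡ true
      class-of v with find (λ i → Ts i (pick′ v))
      ... | inj₁ found = found
      ... | inj₂ none  = ⊥-elim (nonzero _ (pick′-∈ v) (f-off _ none))

      class : Fin n → Fin p
      class v = proj₁ (class-of v)

      class-∈ : ∀ v → Ts (class v) (pick′ v) ≡ true
      class-∈ v = proj₂ (class-of v)

      class-size : Fin p → ℕ
      class-size i = count (λ v → ⌊ class v ≟ i ⌋)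

    crowded-class : ∃[ i ] ns i < class-size i
    crowded-class = sumℕ-< ns class-size (begin-strict
      sumℕ ns                 ≡⟨ Σns ⟩
      n ∸ 1                   <⟨ ≤-reflexive (m+[n∸m]≡n (proj₁ complete)) ⟩
      n                       ≡⟨ count-fibres class ⟨
      sumℕ class-size         ∎)
      where open ≤-Reasoning

    -- The T′-vertices of class i lie in the saturated transversal Tᵢ over pairwise adjacent vertices
    -- of D, so each has at least class-size i - 1 ≥ nᵢ neighbours among them in both directions.
    class-obstruction : ∀ i → ns i < class-size i → Obstruction C T′
    class-obstruction i nsᵢ<kᵢ = record
      { S = S ; S⊆T = λ x Sx → proj₁ (∧-true Sx) ; nonempty = nonempty ; heavy = heavy }
      where
      S : Subset (size (H C))
      S x = T′ x ∧ Ts i x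
      W : Subset n
      W v = ⌊ class v ≟ i ⌋
      lift : ∀ v → W v ≡ true → ∃[ y ] S y ≡ true × X C y ≡ v
      lift v Wv = pick′ v
                , ∧-intro (pick′-∈ v) (subst (λ j → Ts j (pick′ v) ≡ true) (⌊⌋⇒ (class v ≟ i) Wv) (class-∈ v))
                , X-pick′ v
      nonempty : ∃[ x ] S x ≡ true
      nonempty with count-∃ W (≤-<-trans z≤n nsᵢ<kᵢ)
      ... | v , Wv = pick′ v , proj₁ (proj₂ (lift v Wv))
      heavy : ∀ x → S x ≡ true → f C x ≤² degWithin (H C) S x
      heavy x Sx with ∧-true Sx
      ... | T′x , Tsᵢx = subst (_≤² degWithin (H C) S x) (sym (f-on i x Tsᵢx))
        (≤²-trans (subst ((ns i , ns i) ≤²_) (sym (degWithin-complete (D C) complete W (X C x))) (nsᵢ≤ , nsᵢ≤))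
                  (saturated-degWithin C (tr i) (sat i) (λ y Sy → proj₂ (∧-true Sy)) W lift Sx))
        where
        class-X : class (X C x) ≡ i
        class-X = disjoint _ i (pick′ (X C x)) (class-∈ (X C x))
                    (subst (λ y → Ts i y ≡ true) (sym (pick′-X T′x)) Tsᵢx)
        nsᵢ≤ : ns i ≤ count (W ∖ X C x)
        nsᵢ≤ = s≤s⁻¹ (subst (ns i <_) (count-remove W (⇒⌊⌋ (class (X C x) ≟ i) class-X)) nsᵢ<kᵢ)

  obstructed-II : (∀ i → Saturated C (Ts i)) → Obstructed C
  obstructed-II sat = obstructed-by C λ tr′ nonzero →
    class-obstruction sat tr′ nonzero _ (proj₂ (crowded-class sat tr′ nonzero))

module TwoTransversals (C : Config) {T₁ T₂ : Subset (size (H C))}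
  (disjoint : Disjoint C T₁ T₂) (tr₁ : Transversal C T₁) (tr₂ : Transversal C T₂)
  (f-off : ∀ x → (T₁ x ∨ T₂ x) ≡ false → f C x ≡ 𝟘) where

  open Picking C tr₁ public using () renaming (pick to pick₁; pick-∈ to pick₁-∈; X-pick to X-pick₁)
  open Picking C tr₂ public using () renaming (pick to pick₂; pick-∈ to pick₂-∈; X-pick to X-pick₂)

  fibre-sum-pair : ∀ v → sum² (inX C v) (f C) ≡ f C (pick₁ v) ⊕ f C (pick₂ v)
  fibre-sum-pair v = trans (fibre-sum C Ts Ts-disjoint tr f-off′ v) (cong (f C (pick₁ v) ⊕_) (⊕-identityʳ _))
    where
    Ts : Fin 2 → Subset (size (H C))
    Ts = T₁ ∷ T₂ ∷ []
    tr : ∀ i → Transversal C (Ts i)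
    tr zero       = tr₁
    tr (suc zero) = tr₂
    Ts-disjoint : ∀ i j x → Ts i x ≡ true → Ts j x ≡ true → i ≡ j
    Ts-disjoint zero       zero       _ _   _   = refl
    Ts-disjoint (suc zero) (suc zero) _ _   _   = refl
    Ts-disjoint zero       (suc zero) x T₁x T₂x = ⊥-elim (not-¬ T₂x (disjoint x T₁x))
    Ts-disjoint (suc zero) zero       x T₂x T₁x = ⊥-elim (not-¬ T₂x (disjoint x T₁x))
    f-off′ : ∀ x → (∀ i → Ts i x ≡ false) → f C x ≡ 𝟘
    f-off′ x none = f-off x (cong₂ _∨_ (none zero) (none (suc zero)))

  pick₁-∈∪ : ∀ v → (T₁ (pick₁ v) ∨ T₂ (pick₁ v)) ≡ true
  pick₁-∈∪ v = ∨-introˡ _ (pick₁-∈ v)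

  pick₂-∈∪ : ∀ v → (T₁ (pick₂ v) ∨ T₂ (pick₂ v)) ≡ true
  pick₂-∈∪ v = ∨-introʳ _ (pick₂-∈ v)

  ⊆∪ : ∀ {T′ : Subset (size (H C))} → (∀ x → T′ x ≡ true → f C x ≢ 𝟘) →
    ∀ x → T′ x ≡ true → (T₁ x ∨ T₂ x) ≡ true
  ⊆∪ nonzero x T′x = nonzero⇒∈ (λ x → T₁ x ∨ T₂ x) (f C) f-off (nonzero x T′x)

module SymmetricCycle (C : Config) (cycle : InducedSymCycle (D C) full (size (D C)))
  (3≤n : 3 ≤ size (D C)) {T₁ T₂ : Subset (size (H C))}
  (disjoint : Disjoint C T₁ T₂) (tr₁ : Transversal C T₁) (tr₂ : Transversal C T₂)
  (f-on : ∀ x → (T₁ x ∨ T₂ x) ≡ true → f C x ≡ (1 , 1))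
  (f-off : ∀ x → (T₁ x ∨ T₂ x) ≡ false → f C x ≡ 𝟘) where

  open TwoTransversals C disjoint tr₁ tr₂ f-off

  private
    n : ℕ
    n = size (D C)
    σ : Fin n → Fin n
    σ = proj₁ cycle
    σ-adjacent : ∀ i j → (arc (D C) (σ i) (σ j) ≡ true) ⇔ SymAdj n i j
    σ-adjacent = proj₂ (proj₂ (proj₂ cycle))

  balanced-III-IV : Balanced C
  balanced-III-IV v = begin
    sum² (inX C v) (f C)              ≡⟨ fibre-sum-pair v ⟩
    f C (pick₁ v) ⊕ f C (pick₂ v)     ≡⟨ cong₂ _⊕_ (f-on _ (pick₁-∈∪ v)) (f-on _ (pick₂-∈∪ v)) ⟩
    (2 , 2)                           ≡⟨ deg-symmetric-cycle (D C) cycle 3≤n v ⟨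
    deg (D C) v                       ∎
    where open ≡-Reasoning

  module _ {T′ : Subset (size (H C))} (tr′ : Transversal C T′)
           (nonzero : ∀ x → T′ x ≡ true → f C x ≢ 𝟘) where

    private
      open Picking C tr′ renaming (pick to pick′; pick-∈ to pick′-∈; X-pick to X-pick′)

      T′⊆∪ : ∀ x → T′ x ≡ true → (T₁ x ∨ T₂ x) ≡ true
      T′⊆∪ = ⊆∪ {T′} nonzero

      colour : Fin n → Bool
      colour i = T₁ (pick′ (σ i))

    digon-over-edge : ∀ i {T₀} → Transversal C T₀ → Saturated C T₀ →
      T₀ (pick′ (σ i)) ≡ true → T₀ (pick′ (σ (next i))) ≡ true → Obstruction C T′
    digon-over-edge i tr₀ sat₀ T₀a T₀b = digon-obstruction C (pick′-∈ _) (pick′-∈ _)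
      (saturated-arc C tr₀ sat₀ T₀a T₀b (lifted (inj₁ (next-adj i))))
      (saturated-arc C tr₀ sat₀ T₀b T₀a (lifted (inj₂ (next-adj i))))
      (f-on _ (T′⊆∪ _ (pick′-∈ _))) (f-on _ (T′⊆∪ _ (pick′-∈ _)))
      where
      lifted : ∀ {j k} → SymAdj n j k → arc (D C) (X C (pick′ (σ j))) (X C (pick′ (σ k))) ≡ true
      lifted {j} {k} adj = subst₂ (λ u w → arc (D C) u w ≡ true) (sym (X-pick′ (σ j))) (sym (X-pick′ (σ k)))
        (Equivalence.from (σ-adjacent j k) adj)

    obstruction-III : Odd n → Saturated C T₁ → Saturated C T₂ → Obstruction C T′
    obstruction-III odd sat₁ sat₂ with Finₚ.any? (λ i → colour (next i) Bool.≟ colour i)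
    ... | no alternating =
      ⊥-elim (odd-cycle-not-alternating odd colour λ i → ¬-not λ same → alternating (i , same))
    ... | yes (i , same) with ∨-agreeing (T′⊆∪ _ (pick′-∈ (σ i))) (T′⊆∪ _ (pick′-∈ (σ (next i)))) same
    ...   | inj₁ (T₁a , T₁b) = digon-over-edge i tr₁ sat₁ T₁a T₁b
    ...   | inj₂ (T₂a , T₂b) = digon-over-edge i tr₂ sat₂ T₂a T₂b

    obstruction-IV : Even n → InducedSymCycle (H C) (λ x → T₁ x ∨ T₂ x) (n + n) → Obstruction C T′
    obstruction-IV even double-cycle
      with DoubleCover.consecutive C even (≤-trans (n≤1+n 2) 3≤n)
             (symmetric⇒underlying cycle) (symmetric⇒underlying double-cycle) tr′ T′⊆∪
    ... | j , T′a , T′b = digon-obstruction C T′a T′b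
      (Equivalence.from (τ-adjacent j (next j)) (inj₁ (next-adj j)))
      (Equivalence.from (τ-adjacent (next j) j) (inj₂ (next-adj j)))
      (f-on _ (T′⊆∪ _ T′a)) (f-on _ (T′⊆∪ _ T′b))
      where
      τ-adjacent : ∀ i j → (arc (H C) (proj₁ double-cycle i) (proj₁ double-cycle j) ≡ true) ⇔ SymAdj (n + n) i j
      τ-adjacent = proj₂ (proj₂ (proj₂ double-cycle))

  obstructed-III : Odd n → Saturated C T₁ → Saturated C T₂ → Obstructed C
  obstructed-III odd sat₁ sat₂ = obstructed-by C λ tr′ nonzero → obstruction-III tr′ nonzero odd sat₁ sat₂

  obstructed-IV : Even n → InducedSymCycle (H C) (λ x → T₁ x ∨ T₂ x) (n + n) → Obstructed C
  obstructed-IV even double-cycle =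
    obstructed-by C λ tr′ nonzero → obstruction-IV tr′ nonzero even double-cycle

module Antidirected (C : Config) (cycle : InducedAntiCycle (D C) full (size (D C)))
  (4≤n : 4 ≤ size (D C)) (even : Even (size (D C))) {T₁ T₂ : Subset (size (H C))}
  (disjoint : Disjoint C T₁ T₂) (tr₁ : Transversal C T₁) (tr₂ : Transversal C T₂)
  (double-cycle : InducedAntiCycle (H C) (λ x → T₁ x ∨ T₂ x) (size (D C) + size (D C)))
  (f-source : ∀ x → (T₁ x ∨ T₂ x) ≡ true → IsSource (D C) (X C x) → f C x ≡ (1 , 0))
  (f-sink : ∀ x → (T₁ x ∨ T₂ x) ≡ true → IsSink (D C) (X C x) → f C x ≡ (0 , 1))
  (f-off : ∀ x → (T₁ x ∨ T₂ x) ≡ false → f C x ≡ 𝟘) where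

  open TwoTransversals C disjoint tr₁ tr₂ f-off

  private
    3≤n : 3 ≤ size (D C)
    3≤n = ≤-trans (n≤1+n 3) 4≤n
    open UnderlyingCycle (antidirected⇒underlying {H C} double-cycle) using () renaming (adjacent to τ-adjacent)

  balanced-V : Balanced C
  balanced-V v with antidirected-source-or-sink (D C) cycle v
  ... | inj₁ source = begin
    sum² (inX C v) (f C)              ≡⟨ fibre-sum-pair v ⟩
    f C (pick₁ v) ⊕ f C (pick₂ v)     ≡⟨ cong₂ _⊕_
      (f-source _ (pick₁-∈∪ v) (subst (IsSource (D C)) (sym (X-pick₁ v)) source))
      (f-source _ (pick₂-∈∪ v) (subst (IsSource (D C)) (sym (X-pick₂ v)) source)) ⟩
    (2 , 0)                           ≡⟨ deg-antidirected-source (D C) cycle 3≤n v source ⟨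
    deg (D C) v                       ∎
    where open ≡-Reasoning
  ... | inj₂ sink = begin
    sum² (inX C v) (f C)              ≡⟨ fibre-sum-pair v ⟩
    f C (pick₁ v) ⊕ f C (pick₂ v)     ≡⟨ cong₂ _⊕_
      (f-sink _ (pick₁-∈∪ v) (subst (IsSink (D C)) (sym (X-pick₁ v)) sink))
      (f-sink _ (pick₂-∈∪ v) (subst (IsSink (D C)) (sym (X-pick₂ v)) sink)) ⟩
    (0 , 2)                           ≡⟨ deg-antidirected-sink (D C) cycle 3≤n v sink ⟨
    deg (D C) v                       ∎
    where open ≡-Reasoning

  module _ {T′ : Subset (size (H C))} (tr′ : Transversal C T′)
           (nonzero : ∀ x → T′ x ≡ true → f C x ≢ 𝟘) where

    private
      T′⊆∪ : ∀ x → T′ x ≡ true → (T₁ x ∨ T₂ x) ≡ true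
      T′⊆∪ = ⊆∪ {T′} nonzero

    directed-obstruction : ∀ {a b} → T′ a ≡ true → T′ b ≡ true → arc (H C) a b ≡ true → Obstruction C T′
    directed-obstruction {a} {b} T′a T′b a→b = arc-obstruction C T′a T′b a→b fa fb
      where
      Xa→Xb : arc (D C) (X C a) (X C b) ≡ true
      Xa→Xb = arc-projects C a→b
      fa : f C a ≡ (1 , 0)
      fa with antidirected-source-or-sink (D C) cycle (X C a)
      ... | inj₁ source = f-source a (T′⊆∪ a T′a) source
      ... | inj₂ sink   = ⊥-elim (not-¬ Xa→Xb (sink (X C b)))
      fb : f C b ≡ (0 , 1)
      fb with antidirected-source-or-sink (D C) cycle (X C b)
      ... | inj₁ source = ⊥-elim (not-¬ Xa→Xb (source (X C a)))
      ... | inj₂ sink   = f-sink b (T′⊆∪ b T′b) sink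

    obstruction-V : Obstruction C T′
    obstruction-V
      with DoubleCover.consecutive C even (≤-trans (n≤1+n 2) 3≤n)
             (antidirected⇒underlying cycle) (antidirected⇒underlying double-cycle) tr′ T′⊆∪
    ... | j , T′a , T′b with ∨-true (Equivalence.from (τ-adjacent j (next j)) (inj₁ (next-adj j)))
    ...   | inj₁ a→b = directed-obstruction T′a T′b a→b
    ...   | inj₂ b→a = directed-obstruction T′b T′a b→a

  obstructed-V : Obstructed C
  obstructed-V = obstructed-by C obstruction-V

-- Gluing (VI)

Glue-swap : ∀ {C₁ C₂ C} → Glue C₁ C₂ C → Glue C₂ C₁ C
Glue-swap {C₁} {C₂} {C} G = record
  { v₁ = v₂ ; v₂ = v₁ ; φ₁ = φ₂ ; φ₂ = φ₁ ; φ₁-inj = φ₂-inj ; φ₂-inj = φ₁-inj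
  ; φ-glue = sym φ-glue
  ; φ-only = λ a b e → Product.swap (φ-only b a (sym e))
  ; φ-onto = Sum.swap ∘ φ-onto
  ; D-arcs = λ u w → mk⇔ (Sum.swap ∘ Equivalence.to (D-arcs u w)) (Equivalence.from (D-arcs u w) ∘ Sum.swap)
  ; ψ₁ = ψ₂ ; ψ₂ = ψ₁ ; ψ₁-inj = ψ₂-inj ; ψ₂-inj = ψ₁-inj
  ; ψ-only = λ x y e → Product.swap (ψ-only y x (sym e))
  ; π-tot = λ y X₂y≡v₂ → Product.map₂ sym (π-sur y X₂y≡v₂)
  ; π-sur = λ x X₁x≡v₁ → Product.map₂ sym (π-tot x X₁x≡v₁)
  ; ψ-onto = Sum.swap ∘ ψ-onto
  ; X₁-com = X₂-com ; X₂-com = X₁-com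
  ; H-arcs = λ z w → mk⇔ (Sum.swap ∘ Equivalence.to (H-arcs z w)) (Equivalence.from (H-arcs z w) ∘ Sum.swap)
  ; f₁-com = f₂-com ; f₂-com = f₁-com
  ; f-glue = λ y x e → trans (cong (f C) e) (trans (f-glue x y (sym e)) (⊕-comm (f C₁ x) (f C₂ y))) }
  where open Glue G

module Glued {C₁ C₂ C : Config} (G : Glue C₁ C₂ C) where

  open Glue G

  preimage₁ : ∀ {z a} → X C z ≡ φ₁ a → ∃[ x ] ψ₁ x ≡ z
  preimage₁ {z} {a} Xz≡φ₁a with ψ-onto z
  ... | inj₁ found = found
  ... | inj₂ (y , refl) = π-sur y (proj₂ (φ-only a (X C₂ y) (sym (trans (sym (X₂-com y)) Xz≡φ₁a))))

  X₁-reflects : ∀ {x a} → X C (ψ₁ x) ≡ φ₁ a → X C₁ x ≡ a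
  X₁-reflects {x} e = φ₁-inj (trans (sym (X₁-com x)) e)

  fibre-sum-ψ₁ : ∀ a → sum² (inX C (φ₁ a)) (f C) ≡ sum² (inX C₁ a) (f C ∘ ψ₁)
  fibre-sum-ψ₁ a = sum²-reindex (inX C (φ₁ a)) (f C) (inX C₁ a) (f C ∘ ψ₁) (λ x _ → ψ₁ x)
    (λ x x∈ → ⇒⌊⌋ (X C (ψ₁ x) ≟ φ₁ a) (trans (X₁-com x) (cong φ₁ (⌊⌋⇒ (X C₁ x ≟ a) x∈))))
    (λ _ _ → refl) (λ _ _ _ _ → ψ₁-inj) onto
    where
    onto : ∀ z → inX C (φ₁ a) z ≡ true → (∃₂ λ x _ → ψ₁ x ≡ z) ⊎ f C z ≡ 𝟘
    onto z z∈ with preimage₁ (⌊⌋⇒ (X C z ≟ φ₁ a) z∈)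
    ... | x , refl = inj₁ (x , ⇒⌊⌋ (X C₁ x ≟ a) (X₁-reflects (⌊⌋⇒ (X C (ψ₁ x) ≟ φ₁ a) z∈)) , refl)

  fibre-sum-unglued : ∀ a → a ≢ v₁ → sum² (inX C (φ₁ a)) (f C) ≡ sum² (inX C₁ a) (f C₁)
  fibre-sum-unglued a a≢v₁ = trans (fibre-sum-ψ₁ a)
    (sum²-cong (inX C₁ a) λ x x∈ → f₁-com x λ X₁x≡v₁ → a≢v₁ (trans (sym (⌊⌋⇒ (X C₁ x ≟ a) x∈)) X₁x≡v₁))

  fibre-sum-glued : sum² (inX C (φ₁ v₁)) (f C) ≡ sum² (inX C₁ v₁) (f C₁) ⊕ sum² (inX C₂ v₂) (f C₂)
  fibre-sum-glued = begin
    sum² (inX C (φ₁ v₁)) (f C)                          ≡⟨ fibre-sum-ψ₁ v₁ ⟩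
    sum² (inX C₁ v₁) (f C ∘ ψ₁)                         ≡⟨ sum²-cong (inX C₁ v₁) split ⟩
    sum² (inX C₁ v₁) (λ x → f C₁ x ⊕ share₂ x)          ≡⟨ sum²-⊕ (inX C₁ v₁) (f C₁) share₂ ⟩
    sum² (inX C₁ v₁) (f C₁) ⊕ sum² (inX C₁ v₁) share₂   ≡⟨ cong (sum² (inX C₁ v₁) (f C₁) ⊕_) shares ⟩
    sum² (inX C₁ v₁) (f C₁) ⊕ sum² (inX C₂ v₂) (f C₂)   ∎
    where
    open ≡-Reasoning
    -- f C (ψ₁ x) = f C₁ x ⊕ f C₂ y for the partner y of x; truncated subtraction gives the second
    -- summand as a plain function of x.
    share₂ : Fin (size (H C₁)) → ℕ²
    share₂ x = proj₁ (f C (ψ₁ x)) ∸ proj₁ (f C₁ x) , proj₂ (f C (ψ₁ x)) ∸ proj₂ (f C₁ x)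
    share₂-glue : ∀ {x y} → ψ₁ x ≡ ψ₂ y → share₂ x ≡ f C₂ y
    share₂-glue {x} {y} e rewrite f-glue x y e =
      cong₂ _,_ (m+n∸m≡n (proj₁ (f C₁ x)) _) (m+n∸m≡n (proj₂ (f C₁ x)) _)
    split : ∀ x → inX C₁ v₁ x ≡ true → f C (ψ₁ x) ≡ f C₁ x ⊕ share₂ x
    split x x∈ with π-tot x (⌊⌋⇒ (X C₁ x ≟ v₁) x∈)
    ... | y , e = trans (f-glue x y e) (cong (f C₁ x ⊕_) (sym (share₂-glue e)))
    π⁻¹ : ∀ y → inX C₂ v₂ y ≡ true → Fin (size (H C₁))
    π⁻¹ y y∈ = proj₁ (π-sur y (⌊⌋⇒ (X C₂ y ≟ v₂) y∈))
    ψ₁π⁻¹ : ∀ y y∈ → ψ₁ (π⁻¹ y y∈) ≡ ψ₂ y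
    ψ₁π⁻¹ y y∈ = proj₂ (π-sur y (⌊⌋⇒ (X C₂ y ≟ v₂) y∈))
    shares : sum² (inX C₁ v₁) share₂ ≡ sum² (inX C₂ v₂) (f C₂)
    shares = sum²-reindex (inX C₁ v₁) share₂ (inX C₂ v₂) (f C₂) π⁻¹
      (λ y y∈ → ⇒⌊⌋ (X C₁ (π⁻¹ y y∈) ≟ v₁) (proj₁ (ψ-only _ y (ψ₁π⁻¹ y y∈))))
      (λ y y∈ → share₂-glue (ψ₁π⁻¹ y y∈))
      (λ y y′ y∈ y′∈ e → ψ₂-inj (trans (sym (ψ₁π⁻¹ y y∈)) (trans (cong ψ₁ e) (ψ₁π⁻¹ y′ y′∈))))
      onto
      where
      onto : ∀ x → inX C₁ v₁ x ≡ true → (∃₂ λ y y∈ → π⁻¹ y y∈ ≡ x) ⊎ share₂ x ≡ 𝟘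
      onto x x∈ with π-tot x (⌊⌋⇒ (X C₁ x ≟ v₁) x∈)
      ... | y , e = inj₁ (y , y∈ , ψ₁-inj (trans (ψ₁π⁻¹ y y∈) (sym e)))
        where
        y∈ : inX C₂ v₂ y ≡ true
        y∈ = ⇒⌊⌋ (X C₂ y ≟ v₂) (proj₂ (ψ-only x y e))

  arc-from-φ₁ : ∀ {a w} → arc (D C) (φ₁ a) w ≡ true →
    (∃[ b ] arc (D C₁) a b ≡ true × φ₁ b ≡ w) ⊎ (a ≡ v₁ × ∃[ b ] arc (D C₂) v₂ b ≡ true × φ₂ b ≡ w)
  arc-from-φ₁ {a} e with Equivalence.to (D-arcs _ _) e
  ... | inj₁ (a′ , b , φ₁a′≡φ₁a , φ₁b≡w , a′→b) rewrite φ₁-inj φ₁a′≡φ₁a = inj₁ (b , a′→b , φ₁b≡w)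
  ... | inj₂ (a′ , b , φ₂a′≡φ₁a , φ₂b≡w , a′→b) with φ-only a a′ (sym φ₂a′≡φ₁a)
  ...   | refl , refl = inj₂ (refl , b , a′→b , φ₂b≡w)

  arc-to-φ₁ : ∀ {a w} → arc (D C) w (φ₁ a) ≡ true →
    (∃[ b ] arc (D C₁) b a ≡ true × φ₁ b ≡ w) ⊎ (a ≡ v₁ × ∃[ b ] arc (D C₂) b v₂ ≡ true × φ₂ b ≡ w)
  arc-to-φ₁ {a} e with Equivalence.to (D-arcs _ _) e
  ... | inj₁ (b , a′ , φ₁b≡w , φ₁a′≡φ₁a , b→a′) rewrite φ₁-inj φ₁a′≡φ₁a = inj₁ (b , b→a′ , φ₁b≡w)
  ... | inj₂ (b , a′ , φ₂b≡w , φ₂a′≡φ₁a , b→a′) with φ-only a a′ (sym φ₂a′≡φ₁a)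
  ...   | refl , refl = inj₂ (refl , b , b→a′ , φ₂b≡w)

  arc-φ₁ : ∀ {a b} → arc (D C₁) a b ≡ true → arc (D C) (φ₁ a) (φ₁ b) ≡ true
  arc-φ₁ {a} {b} a→b = Equivalence.from (D-arcs _ _) (inj₁ (a , b , refl , refl , a→b))

  arc-φ₂ : ∀ {a b} → arc (D C₂) a b ≡ true → arc (D C) (φ₂ a) (φ₂ b) ≡ true
  arc-φ₂ {a} {b} a→b = Equivalence.from (D-arcs _ _) (inj₂ (a , b , refl , refl , a→b))

  deg-unglued : ∀ a → a ≢ v₁ → deg (D C) (φ₁ a) ≡ deg (D C₁) a
  deg-unglued a a≢v₁ = cong₂ _,_
    (count-reindex _ (arc (D C₁) a) (λ b _ → φ₁ b) (λ _ → arc-φ₁) (λ _ _ _ _ → φ₁-inj) out)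
    (count-reindex _ (λ b → arc (D C₁) b a) (λ b _ → φ₁ b) (λ _ → arc-φ₁) (λ _ _ _ _ → φ₁-inj) in′)
    where
    out : ∀ w → arc (D C) (φ₁ a) w ≡ true → ∃₂ λ b (_ : arc (D C₁) a b ≡ true) → φ₁ b ≡ w
    out w e with arc-from-φ₁ e
    ... | inj₁ found      = found
    ... | inj₂ (a≡v₁ , _) = ⊥-elim (a≢v₁ a≡v₁)
    in′ : ∀ w → arc (D C) w (φ₁ a) ≡ true → ∃₂ λ b (_ : arc (D C₁) b a ≡ true) → φ₁ b ≡ w
    in′ w e with arc-to-φ₁ e
    ... | inj₁ found      = found
    ... | inj₂ (a≡v₁ , _) = ⊥-elim (a≢v₁ a≡v₁)

  deg-glued : deg (D C) (φ₁ v₁) ≡ deg (D C₁) v₁ ⊕ deg (D C₂) v₂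
  deg-glued = cong₂ _,_
    (count-glued φ₁-inj φ₂-inj _ (arc (D C₁) v₁) (arc (D C₂) v₂)
       (λ v₁→b _ → apart (arc (D C₁) v₁) (loopless (D C₁) v₁) v₁→b)
       out arc-φ₁
       λ v₂→b → subst (λ u → arc (D C) u _ ≡ true) (sym φ-glue) (arc-φ₂ v₂→b))
    (count-glued φ₁-inj φ₂-inj _ (λ b → arc (D C₁) b v₁) (λ b → arc (D C₂) b v₂)
       (λ b→v₁ _ → apart (λ b → arc (D C₁) b v₁) (loopless (D C₁) v₁) b→v₁)
       in′ arc-φ₁
       λ b→v₂ → subst (λ u → arc (D C) _ u ≡ true) (sym φ-glue) (arc-φ₂ b→v₂))
    where
    apart : ∀ (R₁ : Subset (size (D C₁))) → R₁ v₁ ≡ false → ∀ {b b′} → R₁ b ≡ true → φ₁ b ≢ φ₂ b′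
    apart R₁ R₁v₁ R₁b φ₁b≡φ₂b′ = not-¬ R₁b (subst (λ b → R₁ b ≡ false) (sym (proj₁ (φ-only _ _ φ₁b≡φ₂b′))) R₁v₁)
    out : ∀ {w} → arc (D C) (φ₁ v₁) w ≡ true →
      (∃[ b ] arc (D C₁) v₁ b ≡ true × φ₁ b ≡ w) ⊎ (∃[ b ] arc (D C₂) v₂ b ≡ true × φ₂ b ≡ w)
    out e with arc-from-φ₁ e
    ... | inj₁ found = inj₁ found
    ... | inj₂ (_ , found) = inj₂ found
    in′ : ∀ {w} → arc (D C) w (φ₁ v₁) ≡ true →
      (∃[ b ] arc (D C₁) b v₁ ≡ true × φ₁ b ≡ w) ⊎ (∃[ b ] arc (D C₂) b v₂ ≡ true × φ₂ b ≡ w)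
    in′ e with arc-to-φ₁ e
    ... | inj₁ found = inj₁ found
    ... | inj₂ (_ , found) = inj₂ found

  balanced-φ₁ : Balanced C₁ → Balanced C₂ → ∀ a → sum² (inX C (φ₁ a)) (f C) ≡ deg (D C) (φ₁ a)
  balanced-φ₁ balanced₁ balanced₂ a with a ≟ v₁
  ... | no a≢v₁ = trans (fibre-sum-unglued a a≢v₁) (trans (balanced₁ a) (sym (deg-unglued a a≢v₁)))
  ... | yes refl = begin
    sum² (inX C (φ₁ v₁)) (f C)                          ≡⟨ fibre-sum-glued ⟩
    sum² (inX C₁ v₁) (f C₁) ⊕ sum² (inX C₂ v₂) (f C₂)   ≡⟨ cong₂ _⊕_ (balanced₁ v₁) (balanced₂ v₂) ⟩
    deg (D C₁) v₁ ⊕ deg (D C₂) v₂                       ≡⟨ deg-glued ⟨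
    deg (D C) (φ₁ v₁)                                   ∎
    where open ≡-Reasoning

  arc-ψ₁ : ∀ {x y} → arc (H C₁) x y ≡ true → arc (H C) (ψ₁ x) (ψ₁ y) ≡ true
  arc-ψ₁ {x} {y} x→y = Equivalence.from (H-arcs _ _) (inj₁ (x , y , refl , refl , x→y))

balanced-VI : ∀ {C₁ C₂ C} → Glue C₁ C₂ C → Balanced C₁ → Balanced C₂ → Balanced C
balanced-VI G balanced₁ balanced₂ v with Glue.φ-onto G v
... | inj₁ (a , refl) = Glued.balanced-φ₁ G balanced₁ balanced₂ a
... | inj₂ (b , refl) = Glued.balanced-φ₁ (Glue-swap G) balanced₂ balanced₁ b

module GluedTransversal {C₁ C₂ C : Config} (G : Glue C₁ C₂ C) {T : Subset (size (H C))}
                        (tr : Transversal C T) where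

  open Glue G
  open Glued G
  open Picking C tr

  T₁ : Subset (size (H C₁))
  T₁ = T ∘ ψ₁

  lift₁ : Fin (size (D C₁)) → Fin (size (H C₁))
  lift₁ a = proj₁ (preimage₁ (X-pick (φ₁ a)))

  ψ₁-lift : ∀ a → ψ₁ (lift₁ a) ≡ pick (φ₁ a)
  ψ₁-lift a = proj₂ (preimage₁ (X-pick (φ₁ a)))

  lift-∈ : ∀ a → T₁ (lift₁ a) ≡ true
  lift-∈ a = subst (λ z → T z ≡ true) (sym (ψ₁-lift a)) (pick-∈ (φ₁ a))

  X-lift : ∀ a → X C₁ (lift₁ a) ≡ a
  X-lift a = X₁-reflects (trans (cong (X C) (ψ₁-lift a)) (X-pick (φ₁ a)))

  restriction₁ : Transversal C₁ T₁
  restriction₁ a = count-singleton _ (∧-intro (lift-∈ a) (⇒⌊⌋ (X C₁ (lift₁ a) ≟ a) (X-lift a))) only-lift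
    where
    only-lift : ∀ x → T₁ x ∧ inX C₁ a x ≡ true → x ≡ lift₁ a
    only-lift x e with ∧-true e
    ... | T₁x , x∈ = ψ₁-inj (unique T₁x (lift-∈ a) (begin
      X C (ψ₁ x)          ≡⟨ X₁-com x ⟩
      φ₁ (X C₁ x)         ≡⟨ cong φ₁ (trans (⌊⌋⇒ (X C₁ x ≟ a) x∈) (sym (X-lift a))) ⟩
      φ₁ (X C₁ (lift₁ a)) ≡⟨ X₁-com (lift₁ a) ⟨
      X C (ψ₁ (lift₁ a))  ∎))
      where open ≡-Reasoning

  x₁ : Fin (size (H C₁))
  x₁ = lift₁ v₁

  only-x₁ : ∀ {x} → T₁ x ≡ true → X C₁ x ≡ v₁ → x ≡ x₁
  only-x₁ T₁x X₁x≡v₁ = Picking.unique C₁ restriction₁ T₁x (lift-∈ v₁) (trans X₁x≡v₁ (sym (X-lift v₁)))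

  module _ (O₁ : Obstruction C₁ T₁) where

    open Obstruction O₁ renaming (S to S₁; S⊆T to S₁⊆T₁; nonempty to S₁-nonempty; heavy to S₁-heavy)

    image-⊆T : ∀ z → image ψ₁ S₁ z ≡ true → T z ≡ true
    image-⊆T z z∈ with image-elim ψ₁ z∈
    ... | x , S₁x , refl = S₁⊆T₁ x S₁x

    unglued-heavy : ∀ {x} → S₁ x ≡ true → X C₁ x ≢ v₁ → f C (ψ₁ x) ≤² degWithin (H C) (image ψ₁ S₁) (ψ₁ x)
    unglued-heavy {x} S₁x X₁x≢v₁ = subst (_≤² degWithin (H C) (image ψ₁ S₁) (ψ₁ x)) (sym (f₁-com x X₁x≢v₁))
      (≤²-trans (S₁-heavy x S₁x) (degWithin-image {H C₁} {H C} ψ₁ ψ₁-inj arc-ψ₁ S₁ x))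

    one-sided : S₁ x₁ ≡ false → Obstruction C T
    one-sided x₁∉S₁ = record
      { S = image ψ₁ S₁ ; S⊆T = image-⊆T
      ; nonempty = ψ₁ (proj₁ S₁-nonempty) , image-intro ψ₁ (proj₂ S₁-nonempty) ; heavy = heavy }
      where
      heavy : ∀ z → image ψ₁ S₁ z ≡ true → f C z ≤² degWithin (H C) (image ψ₁ S₁) z
      heavy z z∈ with image-elim ψ₁ z∈
      ... | x , S₁x , refl = unglued-heavy S₁x λ X₁x≡v₁ →
        not-¬ S₁x (subst (λ x → S₁ x ≡ false) (sym (only-x₁ (S₁⊆T₁ x S₁x) X₁x≡v₁)) x₁∉S₁)

module GluedObstruction {C₁ C₂ C : Config} (G : Glue C₁ C₂ C) {T : Subset (size (H C))}
                        (tr : Transversal C T) where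

  open Glue G
  private
    module Side₁ = GluedTransversal G tr
    module Side₂ = GluedTransversal (Glue-swap G) tr

    x₁ : Fin (size (H C₁))
    x₁ = Side₁.x₁
    y₂ : Fin (size (H C₂))
    y₂ = Side₂.x₁

    x₁≡y₂ : ψ₁ x₁ ≡ ψ₂ y₂
    x₁≡y₂ = trans (Side₁.ψ₁-lift v₁) (trans (cong (Picking.pick C tr) φ-glue) (sym (Side₂.ψ₁-lift v₂)))

  two-sided : (O₁ : Obstruction C₁ Side₁.T₁) (O₂ : Obstruction C₂ Side₂.T₁) →
    Obstruction.S O₁ x₁ ≡ true → Obstruction.S O₂ y₂ ≡ true → Obstruction C T
  two-sided O₁ O₂ x₁∈S₁ y₂∈S₂ = record
    { S = S ; S⊆T = S⊆T ; nonempty = ψ₁ x₁ , ∨-introˡ _ (image-intro ψ₁ x₁∈S₁) ; heavy = heavy }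
    where
    open Obstruction O₁ using () renaming (S to S₁; S⊆T to S₁⊆T₁; heavy to S₁-heavy)
    open Obstruction O₂ using () renaming (S to S₂; S⊆T to S₂⊆T₂; heavy to S₂-heavy)
    S : Subset (size (H C))
    S z = image ψ₁ S₁ z ∨ image ψ₂ S₂ z
    S⊆T : ∀ z → S z ≡ true → T z ≡ true
    S⊆T z z∈ with ∨-true z∈
    ... | inj₁ z∈₁ = Side₁.image-⊆T O₁ z z∈₁
    ... | inj₂ z∈₂ = Side₂.image-⊆T O₂ z z∈₂
    meet-at-glue : ∀ z → image ψ₁ S₁ z ≡ true → image ψ₂ S₂ z ≡ true → z ≡ ψ₁ x₁
    meet-at-glue z z∈₁ z∈₂ with image-elim ψ₁ z∈₁ | image-elim ψ₂ z∈₂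
    ... | x , S₁x , refl | y , _ , ψ₂y≡ψ₁x =
      cong ψ₁ (Side₁.only-x₁ (S₁⊆T₁ x S₁x) (proj₁ (ψ-only x y (sym ψ₂y≡ψ₁x))))
    side₁ : f C₁ x₁ ≤² degWithin (H C) (image ψ₁ S₁) (ψ₁ x₁)
    side₁ = ≤²-trans (S₁-heavy x₁ x₁∈S₁) (degWithin-image {H C₁} {H C} ψ₁ ψ₁-inj (Glued.arc-ψ₁ G) S₁ x₁)
    side₂ : f C₂ y₂ ≤² degWithin (H C) (image ψ₂ S₂) (ψ₁ x₁)
    side₂ = subst (λ z → f C₂ y₂ ≤² degWithin (H C) (image ψ₂ S₂) z) (sym x₁≡y₂)
      (≤²-trans (S₂-heavy y₂ y₂∈S₂) (degWithin-image {H C₂} {H C} ψ₂ ψ₂-inj (Glued.arc-ψ₁ (Glue-swap G)) S₂ y₂))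
    glued-heavy : f C (ψ₁ x₁) ≤² degWithin (H C) S (ψ₁ x₁)
    glued-heavy = subst₂ _≤²_ (sym (f-glue x₁ y₂ x₁≡y₂)) (sym (degWithin-∨ (H C) meet-at-glue))
      (⊕-mono-≤² side₁ side₂)
    heavy : ∀ z → S z ≡ true → f C z ≤² degWithin (H C) S z
    heavy z z∈ with ∨-true z∈
    ... | inj₁ z∈₁ with image-elim ψ₁ z∈₁
    ...   | x , S₁x , refl with X C₁ x ≟ v₁
    ...     | yes X₁x≡v₁ = subst (λ z → f C z ≤² degWithin (H C) S z)
                             (cong ψ₁ (sym (Side₁.only-x₁ (S₁⊆T₁ x S₁x) X₁x≡v₁))) glued-heavy
    ...     | no X₁x≢v₁ =
      ≤²-trans (Side₁.unglued-heavy O₁ S₁x X₁x≢v₁) (degWithin-mono (H C) (λ _ → ∨-introˡ _) _)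
    heavy z z∈ | inj₂ z∈₂ with image-elim ψ₂ z∈₂
    ...   | y , S₂y , refl with X C₂ y ≟ v₂
    ...     | yes X₂y≡v₂ = subst (λ z → f C z ≤² degWithin (H C) S z)
                             (trans x₁≡y₂ (cong ψ₂ (sym (Side₂.only-x₁ (S₂⊆T₂ y S₂y) X₂y≡v₂)))) glued-heavy
    ...     | no X₂y≢v₂ =
      ≤²-trans (Side₂.unglued-heavy O₂ S₂y X₂y≢v₂) (degWithin-mono (H C) (λ _ → ∨-introʳ _) _)

  obstruction : Obstruction C₁ Side₁.T₁ → Obstruction C₂ Side₂.T₁ → Obstruction C T
  obstruction O₁ O₂ with Obstruction.S O₁ x₁ in x₁∈S₁ | Obstruction.S O₂ y₂ in y₂∈S₂
  ... | false | _     = Side₁.one-sided O₁ x₁∈S₁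
  ... | true  | false = Side₂.one-sided O₂ y₂∈S₂
  ... | true  | true  = two-sided O₁ O₂ x₁∈S₁ y₂∈S₂

obstructed-VI : ∀ {C₁ C₂ C} → Glue C₁ C₂ C → Obstructed C₁ → Obstructed C₂ → Obstructed C
obstructed-VI G obstructed₁ obstructed₂ T tr = GluedObstruction.obstruction G tr
  (obstructed₁ _ (GluedTransversal.restriction₁ G tr))
  (obstructed₂ _ (GluedTransversal.restriction₁ (Glue-swap G) tr))

constructible⇒balanced×obstructed : ∀ C → Constructible C → Balanced C × Obstructed C
constructible⇒balanced×obstructed C (caseI _ block T tr sat f-on f-off) =
  balanced-I C tr f-on f-off , obstructed-I C tr f-on f-off (proj₁ (proj₁ block)) sat
constructible⇒balanced×obstructed C (caseII _ complete _ _ ns _ Σns Ts disjoint tr sat f-on f-off) =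
  balanced-II C complete ns Σns Ts disjoint tr f-on f-off ,
  obstructed-II C complete ns Σns Ts disjoint tr f-on f-off sat
constructible⇒balanced×obstructed C (caseIII _ cycle 5≤n odd T₁ T₂ disjoint tr₁ tr₂ sat₁ sat₂ f-on f-off) =
  balanced-III-IV , obstructed-III odd sat₁ sat₂
  where open SymmetricCycle C cycle (≤-trans (+-monoʳ-≤ 3 z≤n) 5≤n) disjoint tr₁ tr₂ f-on f-off
constructible⇒balanced×obstructed C (caseIV _ cycle 4≤n even T₁ T₂ disjoint tr₁ tr₂ double-cycle f-on f-off) =
  balanced-III-IV , obstructed-IV even double-cycle
  where open SymmetricCycle C cycle (≤-trans (n≤1+n 3) 4≤n) disjoint tr₁ tr₂ f-on f-off
constructible⇒balanced×obstructed C
  (caseV _ cycle 4≤n even T₁ T₂ disjoint tr₁ tr₂ double-cycle f-source f-sink f-off) =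
  balanced-V , obstructed-V
  where open Antidirected C cycle 4≤n even disjoint tr₁ tr₂ double-cycle f-source f-sink f-off
constructible⇒balanced×obstructed C (caseVI C₁ C₂ _ constructible₁ constructible₂ _ _ G) =
  balanced-VI G (proj₁ properties₁) (proj₁ properties₂) ,
  obstructed-VI G (proj₂ properties₁) (proj₂ properties₂)
  where
  properties₁ : Balanced C₁ × Obstructed C₁
  properties₁ = constructible⇒balanced×obstructed C₁ constructible₁
  properties₂ : Balanced C₂ × Obstructed C₂
  properties₂ = constructible⇒balanced×obstructed C₂ constructible₂

proposition17 : (C : Config) → Constructible C →
    (∀ v → sum² (inX C v) (f C) ≡ deg (D C) v) × ¬ Colorable C
proposition17 C constructible =
  Product.map₂ obstructed⇒uncolorable (constructible⇒balanced×obstructed C constructible)
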